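{- The systems $\mathsf{NS}_{\mathsf{mLJ}}$, $\mathsf{LNS}_{\mathsf{mLJ}}$, $\mathsf{mLJ}$ and $\mathsf{LbNS}_{\mathsf{mLJ}}$ are equivalent: for all finite multisets of formulae $\Gamma,\Delta$, the sequent $\Gamma\vdash\Delta$ is derivable in $\mathsf{mLJ}$ iff it is derivable (as a nested sequent) in $\mathsf{NS}_{\mathsf{mLJ}}$ iff it is derivable (as a linear nested sequent) in $\mathsf{LNS}_{\mathsf{mLJ}}$ iff $x\!:\!\Gamma\vdash x\!:\!\Delta$ is derivable in $\mathsf{LbNS}_{\mathsf{mLJ}}$.
   Context: Formulae are built from atoms, $\bot,\land,\lor,\supset$; $P$ denotes an atom. (1) $\mathsf{mLJ}$ is Maehara's multi-conclusion sequent calculus: axioms $\Gamma,\bot\vdash\Delta$ and $\Gamma,P\vdash P,\Delta$; rules $\land_L,\land_R,\lor_L,\lor_R$ as in classical context-sharing sequent calculus (e.g. $\Gamma,A\land B\vdash\Delta$ from $\Gamma,A,B\vdash\Delta$; $\Gamma\vdash A\land B,\Delta$ from $\Gamma\vdash A,\Delta$ and $\Gamma\vdash B,\Delta$; $\Gamma,A\lor B\vdash\Delta$ from $\Gamma,A\vdash\Delta$ and $\Gamma,B\vdash\Delta$; $\Gamma\vdash A\lor B,\Delta$ from $\Gamma\vdash A,B,\Delta$); $\supset_L$: $\Gamma,A\supset B\vdash\Delta$ from $\Gamma,A\supset B\vdash A,\Delta$ and $\Gamma,B\vdash\Delta$; $\supset_R$: $\Gamma\vdash A\supset B,\Delta$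 from $\Gamma,A\vdash B$. (2) Nested sequents: a sequent is one; if $G_i$ are nested sequents, $\Gamma\vdash\Delta,[G_1],\ldots,[G_n]$ is one; $\Lambda$ denotes multisets of nestings; $\Upsilon\{\;\}$ is a context with a hole, $\Upsilon\{\Upsilon'\}$ fills it with $[\Upsilon']$ (or equals $\Upsilon'$ if $\Upsilon$ is empty). $\mathsf{NS}_{\mathsf{mLJ}}$ consists of the $\mathsf{mLJ}$ rules for $\land,\lor$, $\bot$, $\mathsf{init}$ and $\supset_L$ applied inside a context, i.e. with each sequent $\Gamma\vdash\Delta$ replaced by $\Upsilon\{\Gamma\vdash\Delta,\Lambda\}$, together with $\supset_R$: $\Upsilon\{\Gamma\vdash\Delta,A\supset B,\Lambda\}$ from $\Upsilon\{\Gamma\vdash\Delta,\Lambda,[A\vdash B]\}$, and $\mathtt{lift}$: $\Upsilon\{\Gamma,A\vdash\Delta,\Lambda,[\Gamma'\vdash\Delta',\Lambda']\}$ from $\Upsilon\{\Gamma,A\vdash\Delta,\Lambda,[\Gamma',A\vdash\Delta',\Lambda']\}$. (3) Linear nested sequents are finite lists of sequents $\Gamma_1\vdash\Delta_1 /\!\!/ \cdots /\!\!/ \Gamma_n\vdash\Delta_n$; $\mathcal{G}$ denotes a (possibly empty) initial segment. $\mathsf{LNS}_{\mathsf{mLJ}}$ has the $\mathsf{mLJ}$ rules for $\land,\lor,\bot,\mathsf{init}$, $\supset_L$ applied to the last component (each sequent $\Gamma\vdash\Delta$ replaced by $\mathcal{G}/\!\!/\Gamma\vdash\Delta$, including both premises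 of two-premise rules; the axiom $\mathsf{init}$ is $\mathcal{G}/\!\!/\Gamma,A\vdash A,\Delta$), plus $\supset_R$: $\mathcal{G}/\!\!/\Gamma\vdash A\supset B,\Delta$ from $\mathcal{G}/\!\!/\Gamma\vdash\Delta/\!\!/A\vdash B$, and $\mathtt{lift}$: $\mathcal{G}/\!\!/\Gamma,A\vdash\Delta/\!\!/\Gamma'\vdash\Delta'$ from $\mathcal{G}/\!\!/\Gamma\vdash\Delta/\!\!/A,\Gamma'\vdash\Delta'$. (4) Labelled nested sequents: $\mathcal{R},X\vdash Y$ where $\mathcal{R}$ is a treelike set of relation terms $xRy$ on state variables, and $X,Y$ are multisets of labelled formulae $x\!:\!A$ (if $\mathcal{R}$ is empty all labels are the same variable; otherwise every label occurs in $\mathcal{R}$); $x\!:\!\Gamma$ denotes $\{x\!:\!A : A\in\Gamma\}$. $\mathsf{LbNS}_{\mathsf{mLJ}}$ is the image of $\mathsf{NS}_{\mathsf{mLJ}}$ under the translation sending each component of a nested sequent to a state variable and each nesting edge to a relation term $xRy$: the propositional rules and axioms act on formulae with a common label $x$ (e.g. $\mathcal{R},X,x\!:\!A\land B\vdash Y$ from $\mathcal{R},X,x\!:\!A,x\!:\!B\vdash Y$; axioms $\mathcal{R},X,x\!:\!P\vdash x\!:\!P,Y$ and $\mathcal{R},X,x\!:\!\bot\vdash Y$), $\supset_R$: $\mathcal{R},X\vdash Y,x\!:\!A\supset B$ from $\mathcal{R},xRy,X,y\!:\!A\vdash Y,y\!:\!B$ with $y$ fresh, and $\mathtt{lift}$: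 $\mathcal{R},xRy,X,x\!:\!A\vdash Y$ from $\mathcal{R},xRy,X,x\!:\!A,y\!:\!A\vdash Y$. -}

module Defs where

open import Data.Nat using (ℕ)
open import Data.List using (List; []; _∷_; _∷ʳ_; map; [_])
open import Data.List.Relation.Binary.Permutation.Propositional using (_↭_)
open import Data.List.Relation.Unary.All using (All)
open import Data.List.Membership.Propositional using (_∈_)
open import Data.Product using (_×_; _,_; proj₁)
open import Relation.Binary.PropositionalEquality using (_≢_)

infixr 8 _∧_
infixr 7 _∨_
infixr 6 _⊃_

data Fm : Set where
  atom : ℕ → Fm
  ⊥̇   : Fm
  _∧_  : Fm → Fm → Fm
  _∨_  : Fm → Fm → Fm
  _⊃_  : Fm → Fm → Fm

-- Finite multisets of formulae are represented by lists; every system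
-- below is closed under permutation of (each) multiset (rule `perm`),
-- so derivability only depends on the underlying multisets.

infix 3 mLJ⊢_⇒_
infix 3 LNS⊢_

data mLJ⊢_⇒_ : List Fm → List Fm → Set where
  perm : ∀ {Γ Γ' Δ Δ'} → Γ ↭ Γ' → Δ ↭ Δ' → mLJ⊢ Γ ⇒ Δ → mLJ⊢ Γ' ⇒ Δ'
  ax⊥  : ∀ {Γ Δ} → mLJ⊢ ⊥̇ ∷ Γ ⇒ Δ
  init : ∀ {Γ Δ} p → mLJ⊢ atom p ∷ Γ ⇒ atom p ∷ Δ
  ∧L   : ∀ {Γ Δ A B} → mLJ⊢ A ∷ B ∷ Γ ⇒ Δ → mLJ⊢ A ∧ B ∷ Γ ⇒ Δ
  ∧R   : ∀ {Γ Δ A B} → mLJ⊢ Γ ⇒ A ∷ Δ → mLJ⊢ Γ ⇒ B ∷ Δ → mLJ⊢ Γ ⇒ A ∧ B ∷ Δ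
  ∨L   : ∀ {Γ Δ A B} → mLJ⊢ A ∷ Γ ⇒ Δ → mLJ⊢ B ∷ Γ ⇒ Δ → mLJ⊢ A ∨ B ∷ Γ ⇒ Δ
  ∨R   : ∀ {Γ Δ A B} → mLJ⊢ Γ ⇒ A ∷ B ∷ Δ → mLJ⊢ Γ ⇒ A ∨ B ∷ Δ
  ⊃L   : ∀ {Γ Δ A B} → mLJ⊢ A ⊃ B ∷ Γ ⇒ A ∷ Δ → mLJ⊢ B ∷ Γ ⇒ Δ
       → mLJ⊢ A ⊃ B ∷ Γ ⇒ Δ
  ⊃R   : ∀ {Γ Δ A B} → mLJ⊢ A ∷ Γ ⇒ B ∷ [] → mLJ⊢ Γ ⇒ A ⊃ B ∷ Δ

-- (2) Nested sequents  Γ ⊢ Δ, [G₁], …, [Gₙ]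

data NSeq : Set where
  nest : List Fm → List Fm → List NSeq → NSeq

data _≈N_ : NSeq → NSeq → Set
data _≈Λ_ : List NSeq → List NSeq → Set

data _≈N_ where
  nest≈ : ∀ {Γ Γ' Δ Δ' Λ Λ'} → Γ ↭ Γ' → Δ ↭ Δ' → Λ ≈Λ Λ'
        → nest Γ Δ Λ ≈N nest Γ' Δ' Λ'

data _≈Λ_ where
  []    : [] ≈Λ []
  _∷_   : ∀ {N N' Λ Λ'} → N ≈N N' → Λ ≈Λ Λ' → (N ∷ Λ) ≈Λ (N' ∷ Λ')
  swap  : ∀ {N M Λ} → (N ∷ M ∷ Λ) ≈Λ (M ∷ N ∷ Λ)
  trans : ∀ {Λ Λ' Λ''} → Λ ≈Λ Λ' → Λ' ≈Λ Λ'' → Λ ≈Λ Λ''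

-- contexts Υ{ } : a nested sequent with a hole in place of a nesting;
-- `hole` is the empty context (Υ{N} = N)
data Ctx : Set where
  hole : Ctx
  down : List Fm → List Fm → List NSeq → Ctx → Ctx

plug : Ctx → NSeq → NSeq
plug hole N = N
plug (down Γ Δ Λ C) N = nest Γ Δ (Λ ∷ʳ plug C N)

data NS⊢_ : NSeq → Set where
  perm : ∀ {N N'} → N ≈N N' → NS⊢ N → NS⊢ N'
  ax⊥  : ∀ {Υ Γ Δ Λ} → NS⊢ plug Υ (nest (⊥̇ ∷ Γ) Δ Λ)
  init : ∀ {Υ Γ Δ Λ} p → NS⊢ plug Υ (nest (atom p ∷ Γ) (atom p ∷ Δ) Λ)
  ∧L   : ∀ {Υ Γ Δ Λ A B} → NS⊢ plug Υ (nest (A ∷ B ∷ Γ) Δ Λ)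
       → NS⊢ plug Υ (nest (A ∧ B ∷ Γ) Δ Λ)
  ∧R   : ∀ {Υ Γ Δ Λ A B} → NS⊢ plug Υ (nest Γ (A ∷ Δ) Λ)
       → NS⊢ plug Υ (nest Γ (B ∷ Δ) Λ)
       → NS⊢ plug Υ (nest Γ (A ∧ B ∷ Δ) Λ)
  ∨L   : ∀ {Υ Γ Δ Λ A B} → NS⊢ plug Υ (nest (A ∷ Γ) Δ Λ)
       → NS⊢ plug Υ (nest (B ∷ Γ) Δ Λ)
       → NS⊢ plug Υ (nest (A ∨ B ∷ Γ) Δ Λ)
  ∨R   : ∀ {Υ Γ Δ Λ A B} → NS⊢ plug Υ (nest Γ (A ∷ B ∷ Δ) Λ)
       → NS⊢ plug Υ (nest Γ (A ∨ B ∷ Δ) Λ)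
  ⊃L   : ∀ {Υ Γ Δ Λ A B} → NS⊢ plug Υ (nest (A ⊃ B ∷ Γ) (A ∷ Δ) Λ)
       → NS⊢ plug Υ (nest (B ∷ Γ) Δ Λ)
       → NS⊢ plug Υ (nest (A ⊃ B ∷ Γ) Δ Λ)
  ⊃R   : ∀ {Υ Γ Δ Λ A B}
       → NS⊢ plug Υ (nest Γ Δ (Λ ∷ʳ nest [ A ] [ B ] []))
       → NS⊢ plug Υ (nest Γ (A ⊃ B ∷ Δ) Λ)
  lift : ∀ {Υ Γ Δ Λ Γ' Δ' Λ' A}
       → NS⊢ plug Υ (nest (A ∷ Γ) Δ (Λ ∷ʳ nest (A ∷ Γ') Δ' Λ'))
       → NS⊢ plug Υ (nest (A ∷ Γ) Δ (Λ ∷ʳ nest Γ' Δ' Λ'))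

-- (3) Linear nested sequents  Γ₁ ⊢ Δ₁ // … // Γₙ ⊢ Δₙ
-- represented as lists of components; 𝒢 // Γ ⊢ Δ  is  𝒢 ∷ʳ (Γ , Δ)

Seq : Set
Seq = List Fm × List Fm

data _≈S_ : Seq → Seq → Set where
  seq≈ : ∀ {Γ Γ' Δ Δ'} → Γ ↭ Γ' → Δ ↭ Δ' → (Γ , Δ) ≈S (Γ' , Δ')

data _≈L_ : List Seq → List Seq → Set where
  []  : [] ≈L []
  _∷_ : ∀ {s s' G G'} → s ≈S s' → G ≈L G' → (s ∷ G) ≈L (s' ∷ G')

data LNS⊢_ : List Seq → Set where
  perm : ∀ {G G'} → G ≈L G' → LNS⊢ G → LNS⊢ G'
  ax⊥  : ∀ {G Γ Δ} → LNS⊢ (G ∷ʳ (⊥̇ ∷ Γ , Δ))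
  init : ∀ {G Γ Δ} A → LNS⊢ (G ∷ʳ (A ∷ Γ , A ∷ Δ))
  ∧L   : ∀ {G Γ Δ A B} → LNS⊢ (G ∷ʳ (A ∷ B ∷ Γ , Δ)) → LNS⊢ (G ∷ʳ (A ∧ B ∷ Γ , Δ))
  ∧R   : ∀ {G Γ Δ A B} → LNS⊢ (G ∷ʳ (Γ , A ∷ Δ)) → LNS⊢ (G ∷ʳ (Γ , B ∷ Δ))
       → LNS⊢ (G ∷ʳ (Γ , A ∧ B ∷ Δ))
  ∨L   : ∀ {G Γ Δ A B} → LNS⊢ (G ∷ʳ (A ∷ Γ , Δ)) → LNS⊢ (G ∷ʳ (B ∷ Γ , Δ))
       → LNS⊢ (G ∷ʳ (A ∨ B ∷ Γ , Δ))
  ∨R   : ∀ {G Γ Δ A B} → LNS⊢ (G ∷ʳ (Γ , A ∷ B ∷ Δ)) → LNS⊢ (G ∷ʳ (Γ , A ∨ B ∷ Δ))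
  ⊃L   : ∀ {G Γ Δ A B} → LNS⊢ (G ∷ʳ (A ⊃ B ∷ Γ , A ∷ Δ)) → LNS⊢ (G ∷ʳ (B ∷ Γ , Δ))
       → LNS⊢ (G ∷ʳ (A ⊃ B ∷ Γ , Δ))
  ⊃R   : ∀ {G Γ Δ A B} → LNS⊢ (G ∷ʳ (Γ , Δ) ∷ʳ ([ A ] , [ B ]))
       → LNS⊢ (G ∷ʳ (Γ , A ⊃ B ∷ Δ))
  lift : ∀ {G Γ Δ Γ' Δ' A} → LNS⊢ (G ∷ʳ (Γ , Δ) ∷ʳ (A ∷ Γ' , Δ'))
       → LNS⊢ (G ∷ʳ (A ∷ Γ , Δ) ∷ʳ (Γ' , Δ'))

-- (4) Labelled nested sequents  ℛ, X ⊢ Y  (state variables are ℕ)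

Rel : Set
Rel = ℕ × ℕ          -- (x , y) stands for xRy

LFm : Set
LFm = ℕ × Fm         -- (x , A) stands for x : A

_∶_ : ℕ → List Fm → List LFm
x ∶ Γ = map (λ A → (x , A)) Γ

Fresh : ℕ → ℕ → List Rel → List LFm → List LFm → Set
Fresh y x ℛ X Y =
  (y ≢ x) × All (λ r → (proj₁ r ≢ y) × (Data.Product.proj₂ r ≢ y)) ℛ
          × All (λ l → proj₁ l ≢ y) X × All (λ l → proj₁ l ≢ y) Y

infix 3 LbNS⊢_∣_⇒_

data LbNS⊢_∣_⇒_ : List Rel → List LFm → List LFm → Set where
  perm : ∀ {ℛ ℛ' X X' Y Y'} → ℛ ↭ ℛ' → X ↭ X' → Y ↭ Y'
       → LbNS⊢ ℛ ∣ X ⇒ Y → LbNS⊢ ℛ' ∣ X' ⇒ Y'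
  ax⊥  : ∀ {ℛ X Y x} → LbNS⊢ ℛ ∣ (x , ⊥̇) ∷ X ⇒ Y
  init : ∀ {ℛ X Y x} p → LbNS⊢ ℛ ∣ (x , atom p) ∷ X ⇒ (x , atom p) ∷ Y
  ∧L   : ∀ {ℛ X Y x A B} → LbNS⊢ ℛ ∣ (x , A) ∷ (x , B) ∷ X ⇒ Y
       → LbNS⊢ ℛ ∣ (x , A ∧ B) ∷ X ⇒ Y
  ∧R   : ∀ {ℛ X Y x A B} → LbNS⊢ ℛ ∣ X ⇒ (x , A) ∷ Y → LbNS⊢ ℛ ∣ X ⇒ (x , B) ∷ Y
       → LbNS⊢ ℛ ∣ X ⇒ (x , A ∧ B) ∷ Y
  ∨L   : ∀ {ℛ X Y x A B} → LbNS⊢ ℛ ∣ (x , A) ∷ X ⇒ Y → LbNS⊢ ℛ ∣ (x , B) ∷ X ⇒ Y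
       → LbNS⊢ ℛ ∣ (x , A ∨ B) ∷ X ⇒ Y
  ∨R   : ∀ {ℛ X Y x A B} → LbNS⊢ ℛ ∣ X ⇒ (x , A) ∷ (x , B) ∷ Y
       → LbNS⊢ ℛ ∣ X ⇒ (x , A ∨ B) ∷ Y
  ⊃L   : ∀ {ℛ X Y x A B} → LbNS⊢ ℛ ∣ (x , A ⊃ B) ∷ X ⇒ (x , A) ∷ Y
       → LbNS⊢ ℛ ∣ (x , B) ∷ X ⇒ Y
       → LbNS⊢ ℛ ∣ (x , A ⊃ B) ∷ X ⇒ Y
  ⊃R   : ∀ {ℛ X Y x y A B} → Fresh y x ℛ X Y
       → LbNS⊢ (x , y) ∷ ℛ ∣ (y , A) ∷ X ⇒ (y , B) ∷ Y
       → LbNS⊢ ℛ ∣ X ⇒ (x , A ⊃ B) ∷ Y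
  lift : ∀ {ℛ X Y x y A} → LbNS⊢ (x , y) ∷ ℛ ∣ (x , A) ∷ (y , A) ∷ X ⇒ Y
       → LbNS⊢ (x , y) ∷ ℛ ∣ (x , A) ∷ X ⇒ Y

module Submission where

-- Each rule becomes the
-- corresponding rule on the last component, except ⊃R: its premise A, Γ ⊢ B
-- is derived in a new component [A ⊢ B] into which Γ is then lifted.
--
-- NS, LNS, LbNS → mLJ: through a Kleene-style calculus K on nested sequents,
-- in which principal formulae are kept and a child inherits the antecedents
-- of its ancestors.  K is monotone, and every NS rule is admissible in K at
-- any depth (deep₀, deep₁, deep₂).  LNS sequents are nested sequents along a
-- chain, and reachable LbNS sequents are represented by labelled trees with
-- distinct labels whose erasure is a nested sequent.  K is sound for mLJ
-- when a nested sequent is read as a formula; this uses admissible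
-- contraction in mLJ, proved first for a height-indexed mLJ by
-- height-preserving inversion.

open import Defs

open import Data.Empty using (⊥-elim)
open import Data.Nat using (ℕ; suc; _≤_; _⊔_; s≤s)
open import Data.Nat.Properties using (m≤m⊔n; m≤n⊔m; n≤1+n; <-irrefl)
open import Data.Product using (Σ; _×_; _,_; proj₁; proj₂)
open import Data.Sum using (_⊎_; inj₁; inj₂)
open import Function.Bundles using (_⇔_; mk⇔)
open import Relation.Binary.PropositionalEquality using (_≡_; _≢_; refl; sym; cong; subst)
import Relation.Binary.PropositionalEquality as ≡

open import Data.List using (List; []; _∷_; _++_; _∷ʳ_; map; [_])
open import Data.List.Properties using (++-identityʳ; ++-assoc; map-++)
open import Data.List.Extrema.Nat using (max; xs≤max)
open import Data.List.Membership.Propositional using (_∈_; _∉_)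
open import Data.List.Membership.Propositional.Properties
  using (∈-++⁺ˡ; ∈-++⁺ʳ; ∈-++⁻; ∈-map⁺; ∈-map⁻; ∈-∃++)
open import Data.List.Relation.Unary.Any using (here; there)
open import Data.List.Relation.Unary.All using (All; []; _∷_)
import Data.List.Relation.Unary.All as All
import Data.List.Relation.Unary.All.Properties as AllP
open import Data.List.Relation.Unary.Unique.Propositional using (Unique; []; _∷_)
open import Data.List.Relation.Binary.Subset.Propositional using (_⊆_)
import Data.List.Relation.Binary.Subset.Propositional.Properties as ⊆
open import Data.List.Relation.Binary.Permutation.Propositional
  using (_↭_; ↭-refl; ↭-trans; ↭-sym; prep; swap; ↭-reflexive; ↭⇒↭ₛ; module PermutationReasoning)
open import Data.List.Relation.Binary.Permutation.Propositional.Properties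
  using (∈-resp-↭; drop-∷; shift; shifts; ++⁺ˡ; ++⁺ʳ; map⁺; ++-comm; ∷↭∷ʳ)
open import Data.List.Relation.Binary.Permutation.Setoid.Properties using (Unique-resp-↭)

module _ {A : Set} where

  ∈⇒↭∷ : {x : A} {xs : List A} → x ∈ xs → Σ (List A) λ ys → xs ↭ x ∷ ys
  ∈⇒↭∷ {x} x∈xs with ∈-∃++ x∈xs
  ... | ys , zs , refl = ys ++ zs , shift x ys zs

  ∷↭∷-cases : {x y : A} {xs ys : List A} → x ∷ xs ↭ y ∷ ys →
    (x ≡ y × xs ↭ ys) ⊎ Σ (List A) (λ zs → xs ↭ y ∷ zs × ys ↭ x ∷ zs)
  ∷↭∷-cases {x} {y} p with ∈-resp-↭ (↭-sym p) (here refl)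
  ... | here refl = inj₁ (refl , drop-∷ p)
  ... | there y∈xs with ∈⇒↭∷ y∈xs
  ... | zs , q = inj₂ (zs , q , ↭-sym (drop-∷ (↭-trans (swap y x ↭-refl)
                                   (↭-trans (prep x (↭-sym q)) p))))

  ∷↭∷∷-cases : {x y : A} {xs ys : List A} → x ∷ xs ↭ y ∷ y ∷ ys →
    (x ≡ y × xs ↭ y ∷ ys) ⊎ Σ (List A) (λ zs → xs ↭ y ∷ y ∷ zs × y ∷ ys ↭ x ∷ y ∷ zs)
  ∷↭∷∷-cases {x} {y} p with ∷↭∷-cases p
  ... | inj₁ split = inj₁ split
  ... | inj₂ (_ , q , r) with ∷↭∷-cases r
  ... | inj₁ (refl , r') = inj₁ (refl , ↭-trans q (prep y (↭-sym r')))
  ... | inj₂ (zs , r₁ , r₂) = inj₂ (zs , ↭-trans q (prep y r₂) , ↭-trans (prep y r₁) (swap y x ↭-refl))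

  ++-underⁿ : (zs ws : List A) {xs ys : List A} → xs ↭ ws ++ ys → zs ++ xs ↭ ws ++ zs ++ ys
  ++-underⁿ zs ws p = ↭-trans (++⁺ˡ zs p) (shifts zs ws)

  ++-under : (zs : List A) {x : A} {xs ys : List A} → xs ↭ x ∷ ys → zs ++ xs ↭ x ∷ zs ++ ys
  ++-under zs {x} = ++-underⁿ zs [ x ]

  ∷-under : (z : A) {x : A} {xs ys : List A} → xs ↭ x ∷ ys → z ∷ xs ↭ x ∷ z ∷ ys
  ∷-under z = ++-under [ z ]

  swap₂ : (x y : A) {xs : List A} → x ∷ y ∷ xs ↭ y ∷ x ∷ xs
  swap₂ x y = swap x y ↭-refl

-- Height-indexed mLJ
--
-- Every rule names its principal formula through a permutation of the
-- context, so permutation is admissible without increasing the height, and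
-- a rule of height n may be read at any greater height.  This is the setting
-- in which inversion and contraction are proved by induction on the height.

infix 3 mLJ[_]⊢_⇒_

data mLJ[_]⊢_⇒_ : ℕ → List Fm → List Fm → Set where
  ax⊥ʰ  : ∀ {n Γ Γ₀ Δ} → Γ ↭ ⊥̇ ∷ Γ₀ → mLJ[ n ]⊢ Γ ⇒ Δ
  initʰ : ∀ {n Γ Γ₀ Δ Δ₀} p → Γ ↭ atom p ∷ Γ₀ → Δ ↭ atom p ∷ Δ₀ → mLJ[ n ]⊢ Γ ⇒ Δ
  ∧Lʰ   : ∀ {n Γ Γ₀ Δ A B} → Γ ↭ A ∧ B ∷ Γ₀ → mLJ[ n ]⊢ A ∷ B ∷ Γ₀ ⇒ Δ
        → mLJ[ suc n ]⊢ Γ ⇒ Δ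
  ∧Rʰ   : ∀ {n Γ Δ Δ₀ A B} → Δ ↭ A ∧ B ∷ Δ₀ → mLJ[ n ]⊢ Γ ⇒ A ∷ Δ₀ → mLJ[ n ]⊢ Γ ⇒ B ∷ Δ₀
        → mLJ[ suc n ]⊢ Γ ⇒ Δ
  ∨Lʰ   : ∀ {n Γ Γ₀ Δ A B} → Γ ↭ A ∨ B ∷ Γ₀ → mLJ[ n ]⊢ A ∷ Γ₀ ⇒ Δ → mLJ[ n ]⊢ B ∷ Γ₀ ⇒ Δ
        → mLJ[ suc n ]⊢ Γ ⇒ Δ
  ∨Rʰ   : ∀ {n Γ Δ Δ₀ A B} → Δ ↭ A ∨ B ∷ Δ₀ → mLJ[ n ]⊢ Γ ⇒ A ∷ B ∷ Δ₀
        → mLJ[ suc n ]⊢ Γ ⇒ Δ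
  ⊃Lʰ   : ∀ {n Γ Γ₀ Δ A B} → Γ ↭ A ⊃ B ∷ Γ₀ → mLJ[ n ]⊢ Γ ⇒ A ∷ Δ → mLJ[ n ]⊢ B ∷ Γ₀ ⇒ Δ
        → mLJ[ suc n ]⊢ Γ ⇒ Δ
  ⊃Rʰ   : ∀ {n Γ Δ Δ₀ A B} → Δ ↭ A ⊃ B ∷ Δ₀ → mLJ[ n ]⊢ A ∷ Γ ⇒ B ∷ []
        → mLJ[ suc n ]⊢ Γ ⇒ Δ

permʰ : ∀ {n Γ Γ' Δ Δ'} → mLJ[ n ]⊢ Γ ⇒ Δ → Γ ↭ Γ' → Δ ↭ Δ' → mLJ[ n ]⊢ Γ' ⇒ Δ'
permʰ (ax⊥ʰ q) g e = ax⊥ʰ (↭-trans (↭-sym g) q)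
permʰ (initʰ p q r) g e = initʰ p (↭-trans (↭-sym g) q) (↭-trans (↭-sym e) r)
permʰ (∧Lʰ q d) g e = ∧Lʰ (↭-trans (↭-sym g) q) (permʰ d ↭-refl e)
permʰ (∧Rʰ q d₁ d₂) g e = ∧Rʰ (↭-trans (↭-sym e) q) (permʰ d₁ g ↭-refl) (permʰ d₂ g ↭-refl)
permʰ (∨Lʰ q d₁ d₂) g e = ∨Lʰ (↭-trans (↭-sym g) q) (permʰ d₁ ↭-refl e) (permʰ d₂ ↭-refl e)
permʰ (∨Rʰ q d) g e = ∨Rʰ (↭-trans (↭-sym e) q) (permʰ d g ↭-refl)
permʰ (⊃Lʰ {A = A} q d₁ d₂) g e = ⊃Lʰ (↭-trans (↭-sym g) q) (permʰ d₁ g (prep A e)) (permʰ d₂ ↭-refl e)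
permʰ (⊃Rʰ {A = A} q d) g e = ⊃Rʰ (↭-trans (↭-sym e) q) (permʰ d (prep A g) ↭-refl)

raiseʰ : ∀ {n m Γ Δ} → n ≤ m → mLJ[ n ]⊢ Γ ⇒ Δ → mLJ[ m ]⊢ Γ ⇒ Δ
raiseʰ le (ax⊥ʰ q) = ax⊥ʰ q
raiseʰ le (initʰ p q r) = initʰ p q r
raiseʰ (s≤s le) (∧Lʰ q d) = ∧Lʰ q (raiseʰ le d)
raiseʰ (s≤s le) (∧Rʰ q d₁ d₂) = ∧Rʰ q (raiseʰ le d₁) (raiseʰ le d₂)
raiseʰ (s≤s le) (∨Lʰ q d₁ d₂) = ∨Lʰ q (raiseʰ le d₁) (raiseʰ le d₂)
raiseʰ (s≤s le) (∨Rʰ q d) = ∨Rʰ q (raiseʰ le d)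
raiseʰ (s≤s le) (⊃Lʰ q d₁ d₂) = ⊃Lʰ q (raiseʰ le d₁) (raiseʰ le d₂)
raiseʰ (s≤s le) (⊃Rʰ q d) = ⊃Rʰ q (raiseʰ le d)

raise¹ʰ : ∀ {n Γ Δ} → mLJ[ n ]⊢ Γ ⇒ Δ → mLJ[ suc n ]⊢ Γ ⇒ Δ
raise¹ʰ = raiseʰ (n≤1+n _)

weakLʰ : ∀ {n Γ Δ} C → mLJ[ n ]⊢ Γ ⇒ Δ → mLJ[ n ]⊢ C ∷ Γ ⇒ Δ
weakLʰ C (ax⊥ʰ q) = ax⊥ʰ (∷-under C q)
weakLʰ C (initʰ p q r) = initʰ p (∷-under C q) r
weakLʰ C (∧Lʰ {A = A} {B} q d) =
  ∧Lʰ (∷-under C q) (permʰ (weakLʰ C d) (↭-sym (∷-under A (∷-under B ↭-refl))) ↭-refl)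
weakLʰ C (∧Rʰ q d₁ d₂) = ∧Rʰ q (weakLʰ C d₁) (weakLʰ C d₂)
weakLʰ C (∨Lʰ {A = A} {B} q d₁ d₂) =
  ∨Lʰ (∷-under C q) (permʰ (weakLʰ C d₁) (swap₂ C A) ↭-refl) (permʰ (weakLʰ C d₂) (swap₂ C B) ↭-refl)
weakLʰ C (∨Rʰ q d) = ∨Rʰ q (weakLʰ C d)
weakLʰ C (⊃Lʰ {B = B} q d₁ d₂) = ⊃Lʰ (∷-under C q) (weakLʰ C d₁) (permʰ (weakLʰ C d₂) (swap₂ C B) ↭-refl)
weakLʰ C (⊃Rʰ {A = A} q d) = ⊃Rʰ q (permʰ (weakLʰ C d) (swap₂ C A) ↭-refl)

weakRʰ : ∀ {n Γ Δ} C → mLJ[ n ]⊢ Γ ⇒ Δ → mLJ[ n ]⊢ Γ ⇒ C ∷ Δ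
weakRʰ C (ax⊥ʰ q) = ax⊥ʰ q
weakRʰ C (initʰ p q r) = initʰ p q (∷-under C r)
weakRʰ C (∧Lʰ q d) = ∧Lʰ q (weakRʰ C d)
weakRʰ C (∧Rʰ {A = A} {B} q d₁ d₂) =
  ∧Rʰ (∷-under C q) (permʰ (weakRʰ C d₁) ↭-refl (swap₂ C A)) (permʰ (weakRʰ C d₂) ↭-refl (swap₂ C B))
weakRʰ C (∨Lʰ q d₁ d₂) = ∨Lʰ q (weakRʰ C d₁) (weakRʰ C d₂)
weakRʰ C (∨Rʰ {A = A} {B} q d) =
  ∨Rʰ (∷-under C q) (permʰ (weakRʰ C d) ↭-refl (↭-sym (∷-under A (∷-under B ↭-refl))))
weakRʰ C (⊃Lʰ {A = A} q d₁ d₂) = ⊃Lʰ q (permʰ (weakRʰ C d₁) ↭-refl (swap₂ C A)) (weakRʰ C d₂)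
weakRʰ C (⊃Rʰ q d) = ⊃Rʰ (∷-under C q) d

-- `LeftInv Q Ψ`: a left rule with principal formula Q has a premise whose
-- active formulae are Ψ; such a premise follows from the conclusion.
data LeftInv : Fm → List Fm → Set where
  inv∧  : ∀ {A B} → LeftInv (A ∧ B) (A ∷ B ∷ [])
  inv∨₁ : ∀ {A B} → LeftInv (A ∨ B) (A ∷ [])
  inv∨₂ : ∀ {A B} → LeftInv (A ∨ B) (B ∷ [])
  inv⊃  : ∀ {A B} → LeftInv (A ⊃ B) (B ∷ [])

invertLʰ : ∀ {n Γ Δ Q Ψ Γ₀} → LeftInv Q Ψ → mLJ[ n ]⊢ Γ ⇒ Δ → Γ ↭ Q ∷ Γ₀ → mLJ[ n ]⊢ Ψ ++ Γ₀ ⇒ Δ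
invertLʰ il (ax⊥ʰ q) r with ∷↭∷-cases (↭-trans (↭-sym q) r)
invertLʰ () (ax⊥ʰ q) r | inj₁ (refl , _)
invertLʰ {Ψ = Ψ} il (ax⊥ʰ q) r | inj₂ (_ , _ , g) = ax⊥ʰ (++-under Ψ g)
invertLʰ il (initʰ p q s) r with ∷↭∷-cases (↭-trans (↭-sym q) r)
invertLʰ () (initʰ p q s) r | inj₁ (refl , _)
invertLʰ {Ψ = Ψ} il (initʰ p q s) r | inj₂ (_ , _ , g) = initʰ p (++-under Ψ g) s
invertLʰ il (∧Lʰ q d) r with ∷↭∷-cases (↭-trans (↭-sym q) r)
invertLʰ inv∧ (∧Lʰ q d) r | inj₁ (refl , g) = raise¹ʰ (permʰ d (prep _ (prep _ g)) ↭-refl)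
invertLʰ {Ψ = Ψ} il (∧Lʰ {A = A} {B} q d) r | inj₂ (Γ₂ , g₁ , g₂) =
  ∧Lʰ (++-under Ψ g₂) (permʰ (invertLʰ il d (∷-under A (∷-under B g₁))) (shifts Ψ (A ∷ B ∷ [])) ↭-refl)
invertLʰ il (∧Rʰ q d₁ d₂) r = ∧Rʰ q (invertLʰ il d₁ r) (invertLʰ il d₂ r)
invertLʰ il (∨Lʰ q d₁ d₂) r with ∷↭∷-cases (↭-trans (↭-sym q) r)
invertLʰ inv∨₁ (∨Lʰ q d₁ d₂) r | inj₁ (refl , g) = raise¹ʰ (permʰ d₁ (prep _ g) ↭-refl)
invertLʰ inv∨₂ (∨Lʰ q d₁ d₂) r | inj₁ (refl , g) = raise¹ʰ (permʰ d₂ (prep _ g) ↭-refl)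
invertLʰ {Ψ = Ψ} il (∨Lʰ {A = A} {B} q d₁ d₂) r | inj₂ (Γ₂ , g₁ , g₂) =
  ∨Lʰ (++-under Ψ g₂) (permʰ (invertLʰ il d₁ (∷-under A g₁)) (shift A Ψ Γ₂) ↭-refl)
                      (permʰ (invertLʰ il d₂ (∷-under B g₁)) (shift B Ψ Γ₂) ↭-refl)
invertLʰ il (∨Rʰ q d) r = ∨Rʰ q (invertLʰ il d r)
invertLʰ il (⊃Lʰ q d₁ d₂) r with ∷↭∷-cases (↭-trans (↭-sym q) r)
invertLʰ inv⊃ (⊃Lʰ q d₁ d₂) r | inj₁ (refl , g) = raise¹ʰ (permʰ d₂ (prep _ g) ↭-refl)
invertLʰ {Ψ = Ψ} il (⊃Lʰ {B = B} q d₁ d₂) r | inj₂ (Γ₂ , g₁ , g₂) =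
  ⊃Lʰ (++-under Ψ g₂) (invertLʰ il d₁ r) (permʰ (invertLʰ il d₂ (∷-under B g₁)) (shift B Ψ Γ₂) ↭-refl)
invertLʰ {Ψ = Ψ} il (⊃Rʰ {A = A} q d) r =
  ⊃Rʰ q (permʰ (invertLʰ il d (∷-under A r)) (shift A Ψ _) ↭-refl)

-- `RightInv Q Ψ`: the right-hand counterpart (⊃R is not invertible in mLJ)
data RightInv : Fm → List Fm → Set where
  inv∧₁ : ∀ {A B} → RightInv (A ∧ B) (A ∷ [])
  inv∧₂ : ∀ {A B} → RightInv (A ∧ B) (B ∷ [])
  inv∨  : ∀ {A B} → RightInv (A ∨ B) (A ∷ B ∷ [])

invertRʰ : ∀ {n Γ Δ Q Ψ Δ₀} → RightInv Q Ψ → mLJ[ n ]⊢ Γ ⇒ Δ → Δ ↭ Q ∷ Δ₀ → mLJ[ n ]⊢ Γ ⇒ Ψ ++ Δ₀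
invertRʰ ir (ax⊥ʰ q) r = ax⊥ʰ q
invertRʰ ir (initʰ p q s) r with ∷↭∷-cases (↭-trans (↭-sym s) r)
invertRʰ () (initʰ p q s) r | inj₁ (refl , _)
invertRʰ {Ψ = Ψ} ir (initʰ p q s) r | inj₂ (_ , _ , g) = initʰ p q (++-under Ψ g)
invertRʰ ir (∧Lʰ q d) r = ∧Lʰ q (invertRʰ ir d r)
invertRʰ ir (∧Rʰ q d₁ d₂) r with ∷↭∷-cases (↭-trans (↭-sym q) r)
invertRʰ inv∧₁ (∧Rʰ q d₁ d₂) r | inj₁ (refl , g) = raise¹ʰ (permʰ d₁ ↭-refl (prep _ g))
invertRʰ inv∧₂ (∧Rʰ q d₁ d₂) r | inj₁ (refl , g) = raise¹ʰ (permʰ d₂ ↭-refl (prep _ g))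
invertRʰ {Ψ = Ψ} ir (∧Rʰ {A = A} {B} q d₁ d₂) r | inj₂ (Δ₂ , g₁ , g₂) =
  ∧Rʰ (++-under Ψ g₂) (permʰ (invertRʰ ir d₁ (∷-under A g₁)) ↭-refl (shift A Ψ Δ₂))
                      (permʰ (invertRʰ ir d₂ (∷-under B g₁)) ↭-refl (shift B Ψ Δ₂))
invertRʰ ir (∨Lʰ q d₁ d₂) r = ∨Lʰ q (invertRʰ ir d₁ r) (invertRʰ ir d₂ r)
invertRʰ ir (∨Rʰ q d) r with ∷↭∷-cases (↭-trans (↭-sym q) r)
invertRʰ inv∨ (∨Rʰ q d) r | inj₁ (refl , g) = raise¹ʰ (permʰ d ↭-refl (prep _ (prep _ g)))
invertRʰ {Ψ = Ψ} ir (∨Rʰ {A = A} {B} q d) r | inj₂ (Δ₂ , g₁ , g₂) =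
  ∨Rʰ (++-under Ψ g₂) (permʰ (invertRʰ ir d (∷-under A (∷-under B g₁))) ↭-refl (shifts Ψ (A ∷ B ∷ [])))
invertRʰ {Ψ = Ψ} ir (⊃Lʰ {A = A} q d₁ d₂) r =
  ⊃Lʰ q (permʰ (invertRʰ ir d₁ (∷-under A r)) ↭-refl (shift A Ψ _)) (invertRʰ ir d₂ r)
invertRʰ ir (⊃Rʰ q d) r with ∷↭∷-cases (↭-trans (↭-sym q) r)
invertRʰ () (⊃Rʰ q d) r | inj₁ (refl , _)
invertRʰ {Ψ = Ψ} ir (⊃Rʰ q d) r | inj₂ (_ , _ , g) = ⊃Rʰ (++-under Ψ g) d

-- height-preserving contraction, by induction on the height; when the
-- contracted formula is principal, the other copy is removed by inversion
-- and the components are contracted at smaller height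
contrLʰ : ∀ A {n Γ Δ Γ₀} → mLJ[ n ]⊢ Γ ⇒ Δ → Γ ↭ A ∷ A ∷ Γ₀ → mLJ[ n ]⊢ A ∷ Γ₀ ⇒ Δ
contrLʰ A (ax⊥ʰ q) r with ∷↭∷∷-cases (↭-trans (↭-sym q) r)
... | inj₁ (refl , _) = ax⊥ʰ ↭-refl
... | inj₂ (_ , _ , g) = ax⊥ʰ g
contrLʰ A (initʰ p q s) r with ∷↭∷∷-cases (↭-trans (↭-sym q) r)
... | inj₁ (refl , _) = initʰ p ↭-refl s
... | inj₂ (_ , _ , g) = initʰ p g s
contrLʰ A (∧Lʰ {A = C} {E} q d) r with ∷↭∷∷-cases (↭-trans (↭-sym q) r)
... | inj₁ (refl , g) =
  ∧Lʰ ↭-refl (permʰ (contrLʰ E (contrLʰ C (permʰ d₂ (prep C (swap₂ E C)) ↭-refl) ↭-refl)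
                      (↭-sym (∷-under E (∷-under E ↭-refl)))) (swap₂ E C) ↭-refl)
  where d₂ = invertLʰ inv∧ d (∷-under C (∷-under E g))
... | inj₂ (_ , g₁ , g) =
  ∧Lʰ g (permʰ (contrLʰ A d (++-underⁿ (C ∷ E ∷ []) (A ∷ A ∷ []) g₁))
                (↭-sym (∷-under C (∷-under E ↭-refl))) ↭-refl)
contrLʰ A (∧Rʰ q d₁ d₂) r = ∧Rʰ q (contrLʰ A d₁ r) (contrLʰ A d₂ r)
contrLʰ A (∨Lʰ {A = C} {E} q d₁ d₂) r with ∷↭∷∷-cases (↭-trans (↭-sym q) r)
... | inj₁ (refl , g) =
  ∨Lʰ ↭-refl (contrLʰ C (invertLʰ inv∨₁ d₁ (∷-under C g)) ↭-refl)
             (contrLʰ E (invertLʰ inv∨₂ d₂ (∷-under E g)) ↭-refl)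
... | inj₂ (_ , g₁ , g) =
  ∨Lʰ g (permʰ (contrLʰ A d₁ (++-underⁿ (C ∷ []) (A ∷ A ∷ []) g₁)) (swap₂ A C) ↭-refl)
        (permʰ (contrLʰ A d₂ (++-underⁿ (E ∷ []) (A ∷ A ∷ []) g₁)) (swap₂ A E) ↭-refl)
contrLʰ A (∨Rʰ q d) r = ∨Rʰ q (contrLʰ A d r)
contrLʰ A (⊃Lʰ {A = C} {E} q d₁ d₂) r with ∷↭∷∷-cases (↭-trans (↭-sym q) r)
... | inj₁ (refl , g) =
  ⊃Lʰ ↭-refl (contrLʰ A d₁ r) (contrLʰ E (invertLʰ inv⊃ d₂ (∷-under E g)) ↭-refl)
... | inj₂ (_ , g₁ , g) =
  ⊃Lʰ g (contrLʰ A d₁ r) (permʰ (contrLʰ A d₂ (++-underⁿ (E ∷ []) (A ∷ A ∷ []) g₁)) (swap₂ A E) ↭-refl)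
contrLʰ A (⊃Rʰ {A = C} q d) r =
  ⊃Rʰ q (permʰ (contrLʰ A d (++-underⁿ (C ∷ []) (A ∷ A ∷ []) r)) (swap₂ A C) ↭-refl)

contrRʰ : ∀ A {n Γ Δ Δ₀} → mLJ[ n ]⊢ Γ ⇒ Δ → Δ ↭ A ∷ A ∷ Δ₀ → mLJ[ n ]⊢ Γ ⇒ A ∷ Δ₀
contrRʰ A (ax⊥ʰ q) r = ax⊥ʰ q
contrRʰ A (initʰ p q s) r with ∷↭∷∷-cases (↭-trans (↭-sym s) r)
... | inj₁ (refl , _) = initʰ p q ↭-refl
... | inj₂ (_ , _ , g) = initʰ p q g
contrRʰ A (∧Lʰ q d) r = ∧Lʰ q (contrRʰ A d r)
contrRʰ A (∧Rʰ {A = C} {E} q d₁ d₂) r with ∷↭∷∷-cases (↭-trans (↭-sym q) r)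
... | inj₁ (refl , g) =
  ∧Rʰ ↭-refl (contrRʰ C (invertRʰ inv∧₁ d₁ (∷-under C g)) ↭-refl)
             (contrRʰ E (invertRʰ inv∧₂ d₂ (∷-under E g)) ↭-refl)
... | inj₂ (_ , g₁ , g) =
  ∧Rʰ g (permʰ (contrRʰ A d₁ (++-underⁿ (C ∷ []) (A ∷ A ∷ []) g₁)) ↭-refl (swap₂ A C))
        (permʰ (contrRʰ A d₂ (++-underⁿ (E ∷ []) (A ∷ A ∷ []) g₁)) ↭-refl (swap₂ A E))
contrRʰ A (∨Lʰ q d₁ d₂) r = ∨Lʰ q (contrRʰ A d₁ r) (contrRʰ A d₂ r)
contrRʰ A (∨Rʰ {A = C} {E} q d) r with ∷↭∷∷-cases (↭-trans (↭-sym q) r)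
... | inj₁ (refl , g) =
  ∨Rʰ ↭-refl (permʰ (contrRʰ E (contrRʰ C (permʰ d₂ ↭-refl (prep C (swap₂ E C))) ↭-refl)
                      (↭-sym (∷-under E (∷-under E ↭-refl)))) ↭-refl (swap₂ E C))
  where d₂ = invertRʰ inv∨ d (∷-under C (∷-under E g))
... | inj₂ (_ , g₁ , g) =
  ∨Rʰ g (permʰ (contrRʰ A d (++-underⁿ (C ∷ E ∷ []) (A ∷ A ∷ []) g₁))
                ↭-refl (↭-sym (∷-under C (∷-under E ↭-refl))))
contrRʰ A (⊃Lʰ {A = C} q d₁ d₂) r =
  ⊃Lʰ q (permʰ (contrRʰ A d₁ (++-underⁿ (C ∷ []) (A ∷ A ∷ []) r)) ↭-refl (swap₂ A C)) (contrRʰ A d₂ r)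
contrRʰ A (⊃Rʰ q d) r with ∷↭∷∷-cases (↭-trans (↭-sym q) r)
... | inj₁ (refl , _) = ⊃Rʰ ↭-refl d
... | inj₂ (_ , _ , g) = ⊃Rʰ g d

commonHeight : ∀ {Γ₁ Δ₁ Γ₂ Δ₂} → Σ ℕ (λ n → mLJ[ n ]⊢ Γ₁ ⇒ Δ₁) → Σ ℕ (λ m → mLJ[ m ]⊢ Γ₂ ⇒ Δ₂)
             → Σ ℕ λ k → mLJ[ k ]⊢ Γ₁ ⇒ Δ₁ × mLJ[ k ]⊢ Γ₂ ⇒ Δ₂
commonHeight (n , d₁) (m , d₂) = n ⊔ m , raiseʰ (m≤m⊔n n m) d₁ , raiseʰ (m≤n⊔m n m) d₂

toʰ : ∀ {Γ Δ} → mLJ⊢ Γ ⇒ Δ → Σ ℕ λ n → mLJ[ n ]⊢ Γ ⇒ Δ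
toʰ (perm g e d) = let n , dʰ = toʰ d in n , permʰ dʰ g e
toʰ ax⊥ = 0 , ax⊥ʰ ↭-refl
toʰ (init p) = 0 , initʰ p ↭-refl ↭-refl
toʰ (∧L d) = let n , dʰ = toʰ d in suc n , ∧Lʰ ↭-refl dʰ
toʰ (∧R d₁ d₂) = let n , e₁ , e₂ = commonHeight (toʰ d₁) (toʰ d₂) in suc n , ∧Rʰ ↭-refl e₁ e₂
toʰ (∨L d₁ d₂) = let n , e₁ , e₂ = commonHeight (toʰ d₁) (toʰ d₂) in suc n , ∨Lʰ ↭-refl e₁ e₂
toʰ (∨R d) = let n , dʰ = toʰ d in suc n , ∨Rʰ ↭-refl dʰ
toʰ (⊃L d₁ d₂) = let n , e₁ , e₂ = commonHeight (toʰ d₁) (toʰ d₂) in suc n , ⊃Lʰ ↭-refl e₁ e₂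
toʰ (⊃R d) = let n , dʰ = toʰ d in suc n , ⊃Rʰ ↭-refl dʰ

fromʰ : ∀ {n Γ Δ} → mLJ[ n ]⊢ Γ ⇒ Δ → mLJ⊢ Γ ⇒ Δ
fromʰ (ax⊥ʰ q) = perm (↭-sym q) ↭-refl ax⊥
fromʰ (initʰ p q r) = perm (↭-sym q) (↭-sym r) (init p)
fromʰ (∧Lʰ q d) = perm (↭-sym q) ↭-refl (∧L (fromʰ d))
fromʰ (∧Rʰ q d₁ d₂) = perm ↭-refl (↭-sym q) (∧R (fromʰ d₁) (fromʰ d₂))
fromʰ (∨Lʰ q d₁ d₂) = perm (↭-sym q) ↭-refl (∨L (fromʰ d₁) (fromʰ d₂))
fromʰ (∨Rʰ q d) = perm ↭-refl (↭-sym q) (∨R (fromʰ d))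
fromʰ (⊃Lʰ q d₁ d₂) = perm (↭-sym q) ↭-refl (⊃L (perm q ↭-refl (fromʰ d₁)) (fromʰ d₂))
fromʰ (⊃Rʰ q d) = perm ↭-refl (↭-sym q) (⊃R (fromʰ d))

contrL : ∀ {A Γ Δ} → mLJ⊢ A ∷ A ∷ Γ ⇒ Δ → mLJ⊢ A ∷ Γ ⇒ Δ
contrL {A} d = fromʰ (contrLʰ A (proj₂ (toʰ d)) ↭-refl)

contrR : ∀ {A Γ Δ} → mLJ⊢ Γ ⇒ A ∷ A ∷ Δ → mLJ⊢ Γ ⇒ A ∷ Δ
contrR {A} d = fromʰ (contrRʰ A (proj₂ (toʰ d)) ↭-refl)

weakL : ∀ {Γ Δ} C → mLJ⊢ Γ ⇒ Δ → mLJ⊢ C ∷ Γ ⇒ Δ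
weakL C d = fromʰ (weakLʰ C (proj₂ (toʰ d)))

weakR : ∀ {Γ Δ} C → mLJ⊢ Γ ⇒ Δ → mLJ⊢ Γ ⇒ C ∷ Δ
weakR C d = fromʰ (weakRʰ C (proj₂ (toʰ d)))

-- The Kleene-style nested calculus K
--
-- `K⊢ Θ ⇒ Δ ∣ Λ` says that the component with antecedent Θ, succedent Δ
-- and children Λ is derivable, where Θ also contains every antecedent
-- formula of the ancestors.  Principal formulae need only be members and
-- are kept in the premises, so contraction and the lift rule are built in;
-- `kopen` continues the derivation in a child.

infix 3 K⊢_⇒_∣_

data K⊢_⇒_∣_ : List Fm → List Fm → List NSeq → Set where
  kax⊥  : ∀ {Θ Δ Λ} → ⊥̇ ∈ Θ → K⊢ Θ ⇒ Δ ∣ Λ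
  kinit : ∀ {Θ Δ Λ} p → atom p ∈ Θ → atom p ∈ Δ → K⊢ Θ ⇒ Δ ∣ Λ
  k∧L   : ∀ {Θ Δ Λ A B} → A ∧ B ∈ Θ → K⊢ A ∷ B ∷ Θ ⇒ Δ ∣ Λ → K⊢ Θ ⇒ Δ ∣ Λ
  k∧R   : ∀ {Θ Δ Λ A B} → A ∧ B ∈ Δ → K⊢ Θ ⇒ A ∷ Δ ∣ Λ → K⊢ Θ ⇒ B ∷ Δ ∣ Λ → K⊢ Θ ⇒ Δ ∣ Λ
  k∨L   : ∀ {Θ Δ Λ A B} → A ∨ B ∈ Θ → K⊢ A ∷ Θ ⇒ Δ ∣ Λ → K⊢ B ∷ Θ ⇒ Δ ∣ Λ → K⊢ Θ ⇒ Δ ∣ Λ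
  k∨R   : ∀ {Θ Δ Λ A B} → A ∨ B ∈ Δ → K⊢ Θ ⇒ A ∷ B ∷ Δ ∣ Λ → K⊢ Θ ⇒ Δ ∣ Λ
  k⊃L   : ∀ {Θ Δ Λ A B} → A ⊃ B ∈ Θ → K⊢ Θ ⇒ A ∷ Δ ∣ Λ → K⊢ B ∷ Θ ⇒ Δ ∣ Λ → K⊢ Θ ⇒ Δ ∣ Λ
  k⊃R   : ∀ {Θ Δ Λ A B} → A ⊃ B ∈ Δ → K⊢ A ∷ Θ ⇒ B ∷ [] ∣ [] → K⊢ Θ ⇒ Δ ∣ Λ
  kopen : ∀ {Θ Δ Λ Γ' Δ' Λ'} → nest Γ' Δ' Λ' ∈ Λ → K⊢ Θ ++ Γ' ⇒ Δ' ∣ Λ' → K⊢ Θ ⇒ Δ ∣ Λ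

K[_]⊢_ : List Fm → NSeq → Set
K[ Σ' ]⊢ nest Γ Δ Λ = K⊢ Σ' ++ Γ ⇒ Δ ∣ Λ

infix 4 _≼_ _≼*_

data _≼_ : NSeq → NSeq → Set where
  cover : ∀ {Γ Γ' Δ Δ' Λ Λ'} → Γ ⊆ Γ' → Δ ⊆ Δ' →
          (∀ {N} → N ∈ Λ → Σ NSeq λ N' → N' ∈ Λ' × N ≼ N') → nest Γ Δ Λ ≼ nest Γ' Δ' Λ'

_≼*_ : List NSeq → List NSeq → Set
Λ ≼* Λ' = ∀ {N} → N ∈ Λ → Σ NSeq λ N' → N' ∈ Λ' × N ≼ N'

≼-refl : ∀ N → N ≼ N
≼*-refl : ∀ Λ → Λ ≼* Λ
≼-refl (nest Γ Δ Λ) = cover ⊆.⊆-refl ⊆.⊆-refl (≼*-refl Λ)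
≼*-refl (N ∷ Λ) (here refl) = N , here refl , ≼-refl N
≼*-refl (N ∷ Λ) (there N∈Λ) = let N' , N'∈Λ , N≼N' = ≼*-refl Λ N∈Λ in N' , there N'∈Λ , N≼N'

≼-trans : ∀ {N₁ N₂ N₃} → N₁ ≼ N₂ → N₂ ≼ N₃ → N₁ ≼ N₃
≼-trans (cover a b f) (cover a' b' g) = cover (⊆.⊆-trans a a') (⊆.⊆-trans b b') λ N∈Λ →
  let N' , N'∈Λ' , p = f N∈Λ ; N'' , N''∈Λ'' , q = g N'∈Λ' in N'' , N''∈Λ'' , ≼-trans p q

kmono : ∀ {Θ Δ Λ Θ' Δ' Λ'} → K⊢ Θ ⇒ Δ ∣ Λ → Θ ⊆ Θ' → Δ ⊆ Δ' → Λ ≼* Λ' → K⊢ Θ' ⇒ Δ' ∣ Λ'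
kmono (kax⊥ m) s t u = kax⊥ (s m)
kmono (kinit p m₁ m₂) s t u = kinit p (s m₁) (t m₂)
kmono (k∧L m d) s t u = k∧L (s m) (kmono d (⊆.∷⁺ʳ _ (⊆.∷⁺ʳ _ s)) t u)
kmono (k∧R m d₁ d₂) s t u = k∧R (t m) (kmono d₁ s (⊆.∷⁺ʳ _ t) u) (kmono d₂ s (⊆.∷⁺ʳ _ t) u)
kmono (k∨L m d₁ d₂) s t u = k∨L (s m) (kmono d₁ (⊆.∷⁺ʳ _ s) t u) (kmono d₂ (⊆.∷⁺ʳ _ s) t u)
kmono (k∨R m d) s t u = k∨R (t m) (kmono d s (⊆.∷⁺ʳ _ (⊆.∷⁺ʳ _ t)) u)
kmono (k⊃L m d₁ d₂) s t u = k⊃L (s m) (kmono d₁ s (⊆.∷⁺ʳ _ t) u) (kmono d₂ (⊆.∷⁺ʳ _ s) t u)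
kmono (k⊃R m d) s t u = k⊃R (t m) (kmono d (⊆.∷⁺ʳ _ s) ⊆.⊆-refl (λ ()))
kmono (kopen m d) s t u with u m
... | nest _ _ _ , m' , cover a b c = kopen m' (kmono d (⊆.++⁺ s a) b c)

K-mono : ∀ {Σ₁ Σ₂ N N'} → Σ₁ ⊆ Σ₂ → N ≼ N' → K[ Σ₁ ]⊢ N → K[ Σ₂ ]⊢ N'
K-mono s (cover a b c) d = kmono d (⊆.++⁺ s a) b c

kid : ∀ A {Θ Δ Λ} → A ∈ Θ → A ∈ Δ → K⊢ Θ ⇒ Δ ∣ Λ
kid (atom p) m₁ m₂ = kinit p m₁ m₂
kid ⊥̇ m₁ m₂ = kax⊥ m₁
kid (A ∧ B) m₁ m₂ =
  k∧R m₂ (k∧L m₁ (kid A (here refl) (here refl))) (k∧L m₁ (kid B (there (here refl)) (here refl)))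
kid (A ∨ B) m₁ m₂ = k∨R m₂ (k∨L m₁ (kid A (here refl) (here refl)) (kid B (here refl) (there (here refl))))
kid (A ⊃ B) m₁ m₂ = k⊃R m₂ (k⊃L (there m₁) (kid A (here refl) (here refl)) (kid B (here refl) (here refl)))

-- Soundness of K for mLJ
--
-- A nested sequent is read as the formula ⋀Γ ⊃ ⋁(Δ, ⟦Λ⟧); a K-derivation of
-- Θ ⇒ Δ ∣ Λ becomes an mLJ-derivation of Θ ⇒ Δ, ⟦Λ⟧.  Kept principal
-- formulae are removed by contraction.

⋀ : List Fm → Fm
⋀ [] = ⊥̇ ⊃ ⊥̇
⋀ (A ∷ Γ) = A ∧ ⋀ Γ

⋁ : List Fm → Fm
⋁ [] = ⊥̇
⋁ (A ∷ Δ) = A ∨ ⋁ Δ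

⟦_⟧ : NSeq → Fm
⟦_⟧* : List NSeq → List Fm
⟦ nest Γ Δ Λ ⟧ = ⋀ Γ ⊃ ⋁ (Δ ++ ⟦ Λ ⟧*)
⟦ [] ⟧* = []
⟦ N ∷ Λ ⟧* = ⟦ N ⟧ ∷ ⟦ Λ ⟧*

∈⟦⟧* : ∀ {N Λ} → N ∈ Λ → ⟦ N ⟧ ∈ ⟦ Λ ⟧*
∈⟦⟧* (here refl) = here refl
∈⟦⟧* (there m) = there (∈⟦⟧* m)

⋁R : ∀ {Γ Δ} As → mLJ⊢ Γ ⇒ As ++ Δ → mLJ⊢ Γ ⇒ ⋁ As ∷ Δ
⋁R [] d = weakR ⊥̇ d
⋁R {Δ = Δ} (A ∷ As) d = ∨R (perm ↭-refl (swap₂ _ _) (⋁R As (perm ↭-refl (↭-sym (shift A As Δ)) d)))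

⋀L : ∀ {Θ Δ} Γs → mLJ⊢ Γs ++ Θ ⇒ Δ → mLJ⊢ ⋀ Γs ∷ Θ ⇒ Δ
⋀L [] d = weakL (⊥̇ ⊃ ⊥̇) d
⋀L {Θ} (A ∷ Γs) d = ∧L (perm (swap₂ _ _) ↭-refl (⋀L Γs (perm (↭-sym (shift A Γs Θ)) ↭-refl d)))

keptL : ∀ {Q Θ Δ} → Q ∈ Θ → mLJ⊢ Q ∷ Θ ⇒ Δ → mLJ⊢ Θ ⇒ Δ
keptL m d with ∈⇒↭∷ m
... | _ , g = perm (↭-sym g) ↭-refl (contrL (perm (prep _ g) ↭-refl d))

keptR : ∀ {Q Θ Δ} → Q ∈ Δ → mLJ⊢ Θ ⇒ Q ∷ Δ → mLJ⊢ Θ ⇒ Δ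
keptR m d with ∈⇒↭∷ m
... | _ , g = perm ↭-refl (↭-sym g) (contrR (perm ↭-refl (prep _ g) d))

K⇒mLJ : ∀ {Θ Δ Λ} → K⊢ Θ ⇒ Δ ∣ Λ → mLJ⊢ Θ ⇒ Δ ++ ⟦ Λ ⟧*
K⇒mLJ (kax⊥ m) = keptL m ax⊥
K⇒mLJ {Λ = Λ} (kinit p m₁ m₂) = keptL m₁ (keptR (∈-++⁺ˡ {ys = ⟦ Λ ⟧*} m₂) (init p))
K⇒mLJ (k∧L m d) = keptL m (∧L (K⇒mLJ d))
K⇒mLJ {Λ = Λ} (k∧R m d₁ d₂) = keptR (∈-++⁺ˡ {ys = ⟦ Λ ⟧*} m) (∧R (K⇒mLJ d₁) (K⇒mLJ d₂))
K⇒mLJ (k∨L m d₁ d₂) = keptL m (∨L (K⇒mLJ d₁) (K⇒mLJ d₂))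
K⇒mLJ {Λ = Λ} (k∨R m d) = keptR (∈-++⁺ˡ {ys = ⟦ Λ ⟧*} m) (∨R (K⇒mLJ d))
K⇒mLJ (k⊃L {A = A} {B} m d₁ d₂) = keptL m (⊃L (weakL (A ⊃ B) (K⇒mLJ d₁)) (K⇒mLJ d₂))
K⇒mLJ {Λ = Λ} (k⊃R m d) = keptR (∈-++⁺ˡ {ys = ⟦ Λ ⟧*} m) (⊃R (K⇒mLJ d))
K⇒mLJ {Θ} {Δ} (kopen {Γ' = Γ'} {Δ'} {Λ'} m d) =
  keptR (∈-++⁺ʳ Δ (∈⟦⟧* m))
    (⊃R (⋀L Γ' (perm (++-comm Θ Γ') ↭-refl
      (⋁R (Δ' ++ ⟦ Λ' ⟧*) (perm ↭-refl (↭-reflexive (sym (++-identityʳ (Δ' ++ ⟦ Λ' ⟧*)))) (K⇒mLJ d))))))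

K⇒mLJ₀ : ∀ {Γ Δ} → K[ [] ]⊢ nest Γ Δ [] → mLJ⊢ Γ ⇒ Δ
K⇒mLJ₀ {Δ = Δ} d = perm ↭-refl (↭-reflexive (++-identityʳ Δ)) (K⇒mLJ d)

-- Rules at depth
--
-- A `Path` leads from the root of a nested sequent to one of its
-- components, recording at each level the component's formulae and the
-- children to the left and to the right of the path; `π ⟨ N ⟩` puts N at
-- the end of π.  A rule is admissible at the root when it holds below every
-- inherited antecedent; such rules remain admissible at the end of any path.

data Path : Set where
  root : Path
  step : List Fm → List Fm → List NSeq → List NSeq → Path → Path

_⟨_⟩ : Path → NSeq → NSeq
root ⟨ N ⟩ = N
step Γ Δ Λₗ Λᵣ π ⟨ N ⟩ = nest Γ Δ (Λₗ ++ π ⟨ N ⟩ ∷ Λᵣ)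

Rule₀ : NSeq → Set
Rule₀ C = ∀ Σ' → K[ Σ' ]⊢ C

Rule₁ : NSeq → NSeq → Set
Rule₁ P C = ∀ Σ' → K[ Σ' ]⊢ P → K[ Σ' ]⊢ C

Rule₂ : NSeq → NSeq → NSeq → Set
Rule₂ P₁ P₂ C = ∀ Σ' → K[ Σ' ]⊢ P₁ → K[ Σ' ]⊢ P₂ → K[ Σ' ]⊢ C

openChild : ∀ {Y Θ Δ Λ} → Y ∈ Λ → K[ Θ ]⊢ Y → K⊢ Θ ⇒ Δ ∣ Λ
openChild {nest Γ Δ Λ} m d = kopen m d

replaceChild : ∀ {X Y Θ Δ} Λₗ Λᵣ → K⊢ Θ ⇒ Δ ∣ Λₗ ++ X ∷ Λᵣ →
               (∀ {Θ'} → Θ ⊆ Θ' → K[ Θ' ]⊢ X → K[ Θ' ]⊢ Y) → K⊢ Θ ⇒ Δ ∣ Λₗ ++ Y ∷ Λᵣ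
replaceChild Λₗ Λᵣ (kax⊥ m) f = kax⊥ m
replaceChild Λₗ Λᵣ (kinit p m₁ m₂) f = kinit p m₁ m₂
replaceChild Λₗ Λᵣ (k∧L m d) f = k∧L m (replaceChild Λₗ Λᵣ d (λ s → f (λ x → s (there (there x)))))
replaceChild Λₗ Λᵣ (k∧R m d₁ d₂) f = k∧R m (replaceChild Λₗ Λᵣ d₁ f) (replaceChild Λₗ Λᵣ d₂ f)
replaceChild Λₗ Λᵣ (k∨L m d₁ d₂) f =
  k∨L m (replaceChild Λₗ Λᵣ d₁ (λ s → f (λ x → s (there x)))) (replaceChild Λₗ Λᵣ d₂ (λ s → f (λ x → s (there x))))
replaceChild Λₗ Λᵣ (k∨R m d) f = k∨R m (replaceChild Λₗ Λᵣ d f)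
replaceChild Λₗ Λᵣ (k⊃L m d₁ d₂) f =
  k⊃L m (replaceChild Λₗ Λᵣ d₁ f) (replaceChild Λₗ Λᵣ d₂ (λ s → f (λ x → s (there x))))
replaceChild Λₗ Λᵣ (k⊃R m d) f = k⊃R m d
replaceChild Λₗ Λᵣ (kopen m d) f with ∈-++⁻ Λₗ m
... | inj₁ m' = kopen (∈-++⁺ˡ m') d
... | inj₂ (here refl) = openChild (∈-++⁺ʳ Λₗ (here refl)) (f ⊆.⊆-refl d)
... | inj₂ (there m') = kopen (∈-++⁺ʳ Λₗ (there m')) d

-- The first
-- derivation is followed until it opens X₁ (mergeFirst); from there the
-- second one is followed until it opens X₂ (mergeSecond), where the rule
-- is applied.
mergeSecond : ∀ {X₁ X₂ Y Θ₀ Θ Δ} Λₗ Λᵣ → Rule₂ X₁ X₂ Y →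
              K[ Θ₀ ]⊢ X₁ → Θ₀ ⊆ Θ → K⊢ Θ ⇒ Δ ∣ Λₗ ++ X₂ ∷ Λᵣ → K⊢ Θ ⇒ Δ ∣ Λₗ ++ Y ∷ Λᵣ
mergeSecond Λₗ Λᵣ f e s (kax⊥ m) = kax⊥ m
mergeSecond Λₗ Λᵣ f e s (kinit p m₁ m₂) = kinit p m₁ m₂
mergeSecond Λₗ Λᵣ f e s (k∧L m d) = k∧L m (mergeSecond Λₗ Λᵣ f e (λ x → there (there (s x))) d)
mergeSecond Λₗ Λᵣ f e s (k∧R m d₁ d₂) = k∧R m (mergeSecond Λₗ Λᵣ f e s d₁) (mergeSecond Λₗ Λᵣ f e s d₂)
mergeSecond Λₗ Λᵣ f e s (k∨L m d₁ d₂) =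
  k∨L m (mergeSecond Λₗ Λᵣ f e (λ x → there (s x)) d₁) (mergeSecond Λₗ Λᵣ f e (λ x → there (s x)) d₂)
mergeSecond Λₗ Λᵣ f e s (k∨R m d) = k∨R m (mergeSecond Λₗ Λᵣ f e s d)
mergeSecond Λₗ Λᵣ f e s (k⊃L m d₁ d₂) =
  k⊃L m (mergeSecond Λₗ Λᵣ f e s d₁) (mergeSecond Λₗ Λᵣ f e (λ x → there (s x)) d₂)
mergeSecond Λₗ Λᵣ f e s (k⊃R m d) = k⊃R m d
mergeSecond {X₁} Λₗ Λᵣ f e s (kopen {Θ = Θ} m d) with ∈-++⁻ Λₗ m
... | inj₁ m' = kopen (∈-++⁺ˡ m') d
... | inj₂ (here refl) = openChild (∈-++⁺ʳ Λₗ (here refl)) (f Θ (K-mono s (≼-refl X₁) e) d)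
... | inj₂ (there m') = kopen (∈-++⁺ʳ Λₗ (there m')) d

mergeFirst : ∀ {X₁ X₂ Y Θ Δ Θ₂ Δ₂} Λₗ Λᵣ → Rule₂ X₁ X₂ Y →
             K⊢ Θ ⇒ Δ ∣ Λₗ ++ X₁ ∷ Λᵣ → K⊢ Θ₂ ⇒ Δ₂ ∣ Λₗ ++ X₂ ∷ Λᵣ → Θ₂ ⊆ Θ → Δ₂ ⊆ Δ →
             K⊢ Θ ⇒ Δ ∣ Λₗ ++ Y ∷ Λᵣ
mergeFirst Λₗ Λᵣ f (kax⊥ m) d' s t = kax⊥ m
mergeFirst Λₗ Λᵣ f (kinit p m₁ m₂) d' s t = kinit p m₁ m₂
mergeFirst Λₗ Λᵣ f (k∧L m d) d' s t = k∧L m (mergeFirst Λₗ Λᵣ f d d' (λ x → there (there (s x))) t)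
mergeFirst Λₗ Λᵣ f (k∧R m d₁ d₂) d' s t =
  k∧R m (mergeFirst Λₗ Λᵣ f d₁ d' s (λ x → there (t x))) (mergeFirst Λₗ Λᵣ f d₂ d' s (λ x → there (t x)))
mergeFirst Λₗ Λᵣ f (k∨L m d₁ d₂) d' s t =
  k∨L m (mergeFirst Λₗ Λᵣ f d₁ d' (λ x → there (s x)) t) (mergeFirst Λₗ Λᵣ f d₂ d' (λ x → there (s x)) t)
mergeFirst Λₗ Λᵣ f (k∨R m d) d' s t = k∨R m (mergeFirst Λₗ Λᵣ f d d' s (λ x → there (there (t x))))
mergeFirst Λₗ Λᵣ f (k⊃L m d₁ d₂) d' s t =
  k⊃L m (mergeFirst Λₗ Λᵣ f d₁ d' s (λ x → there (t x))) (mergeFirst Λₗ Λᵣ f d₂ d' (λ x → there (s x)) t)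
mergeFirst Λₗ Λᵣ f (k⊃R m d) d' s t = k⊃R m d
mergeFirst {X₂ = X₂} Λₗ Λᵣ f (kopen m d) d' s t with ∈-++⁻ Λₗ m
... | inj₁ m' = kopen (∈-++⁺ˡ m') d
... | inj₂ (here refl) = mergeSecond Λₗ Λᵣ f d ⊆.⊆-refl (kmono d' s t (≼*-refl (Λₗ ++ X₂ ∷ Λᵣ)))
... | inj₂ (there m') = kopen (∈-++⁺ʳ Λₗ (there m')) d

deep₀ : ∀ {C} → Rule₀ C → ∀ π → Rule₀ (π ⟨ C ⟩)
deep₀ r root Σ' = r Σ'
deep₀ r (step Γ Δ Λₗ Λᵣ π) Σ' = openChild (∈-++⁺ʳ Λₗ (here refl)) (deep₀ r π (Σ' ++ Γ))

deep₁ : ∀ {P C} → Rule₁ P C → ∀ π → Rule₁ (π ⟨ P ⟩) (π ⟨ C ⟩)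
deep₁ r root Σ' d = r Σ' d
deep₁ r (step Γ Δ Λₗ Λᵣ π) Σ' d = replaceChild Λₗ Λᵣ d (λ {Θ'} _ → deep₁ r π Θ')

deep₂ : ∀ {P₁ P₂ C} → Rule₂ P₁ P₂ C → ∀ π → Rule₂ (π ⟨ P₁ ⟩) (π ⟨ P₂ ⟩) (π ⟨ C ⟩)
deep₂ r root Σ' d₁ d₂ = r Σ' d₁ d₂
deep₂ r (step Γ Δ Λₗ Λᵣ π) Σ' d₁ d₂ = mergeFirst Λₗ Λᵣ (λ Θ' → deep₂ r π Θ') d₁ d₂ ⊆.⊆-refl ⊆.⊆-refl

activeFront : ∀ (Σ' Ψ : List Fm) {Γ} → Σ' ++ Ψ ++ Γ ⊆ Ψ ++ Σ' ++ Γ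
activeFront Σ' Ψ = ⊆.⊆-reflexive-↭ (shifts Σ' Ψ)

principalLeft : ∀ (Σ' Ψ : List Fm) {C Γ} → Σ' ++ Ψ ++ Γ ⊆ Ψ ++ Σ' ++ C ∷ Γ
principalLeft Σ' Ψ = ⊆.⊆-trans (activeFront Σ' Ψ) (⊆.++⁺ʳ Ψ (⊆.++⁺ʳ Σ' (⊆.xs⊆x∷xs _ _)))

principalRight : ∀ (Ψ : List Fm) {C Δ} → Ψ ++ Δ ⊆ Ψ ++ C ∷ Δ
principalRight Ψ = ⊆.++⁺ʳ Ψ (⊆.xs⊆x∷xs _ _)

absorbAt : ∀ (Σ' : List Fm) {A Γ} → A ∈ Σ' ++ Γ → Σ' ++ A ∷ Γ ⊆ Σ' ++ Γ
absorbAt Σ' {A} {Γ} a = ⊆.⊆-trans (⊆.⊆-reflexive-↭ (shift A Σ' Γ)) (⊆.∈-∷⁺ʳ a ⊆.⊆-refl)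

⊥ᴷ : ∀ {Γ Δ Λ} → Rule₀ (nest (⊥̇ ∷ Γ) Δ Λ)
⊥ᴷ Σ' = kax⊥ (∈-++⁺ʳ Σ' (here refl))

idᴷ : ∀ {Γ Δ Λ} A → Rule₀ (nest (A ∷ Γ) (A ∷ Δ) Λ)
idᴷ A Σ' = kid A (∈-++⁺ʳ Σ' (here refl)) (here refl)

∧Lᴷ : ∀ {Γ Δ Λ A B} → Rule₁ (nest (A ∷ B ∷ Γ) Δ Λ) (nest (A ∧ B ∷ Γ) Δ Λ)
∧Lᴷ {Λ = Λ} {A} {B} Σ' d = k∧L (∈-++⁺ʳ Σ' (here refl)) (kmono d (principalLeft Σ' (A ∷ B ∷ [])) ⊆.⊆-refl (≼*-refl Λ))

∧Rᴷ : ∀ {Γ Δ Λ A B} → Rule₂ (nest Γ (A ∷ Δ) Λ) (nest Γ (B ∷ Δ) Λ) (nest Γ (A ∧ B ∷ Δ) Λ)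
∧Rᴷ {Λ = Λ} {A} {B} Σ' d₁ d₂ =
  k∧R (here refl) (kmono d₁ ⊆.⊆-refl (principalRight (A ∷ [])) (≼*-refl Λ))
                  (kmono d₂ ⊆.⊆-refl (principalRight (B ∷ [])) (≼*-refl Λ))

∨Lᴷ : ∀ {Γ Δ Λ A B} → Rule₂ (nest (A ∷ Γ) Δ Λ) (nest (B ∷ Γ) Δ Λ) (nest (A ∨ B ∷ Γ) Δ Λ)
∨Lᴷ {Λ = Λ} {A} {B} Σ' d₁ d₂ =
  k∨L (∈-++⁺ʳ Σ' (here refl)) (kmono d₁ (principalLeft Σ' (A ∷ [])) ⊆.⊆-refl (≼*-refl Λ))
                              (kmono d₂ (principalLeft Σ' (B ∷ [])) ⊆.⊆-refl (≼*-refl Λ))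

∨Rᴷ : ∀ {Γ Δ Λ A B} → Rule₁ (nest Γ (A ∷ B ∷ Δ) Λ) (nest Γ (A ∨ B ∷ Δ) Λ)
∨Rᴷ {Λ = Λ} {A} {B} Σ' d =
  k∨R (here refl) (kmono d ⊆.⊆-refl (principalRight (A ∷ B ∷ [])) (≼*-refl Λ))

⊃Lᴷ : ∀ {Γ Δ Λ A B} → Rule₂ (nest (A ⊃ B ∷ Γ) (A ∷ Δ) Λ) (nest (B ∷ Γ) Δ Λ) (nest (A ⊃ B ∷ Γ) Δ Λ)
⊃Lᴷ {Λ = Λ} {B = B} Σ' d₁ d₂ =
  k⊃L (∈-++⁺ʳ Σ' (here refl)) d₁ (kmono d₂ (principalLeft Σ' (B ∷ [])) ⊆.⊆-refl (≼*-refl Λ))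

closeChild : ∀ {Θ Δ A B} Λₗ Λᵣ → K⊢ Θ ⇒ Δ ∣ Λₗ ++ nest [ A ] [ B ] [] ∷ Λᵣ → K⊢ Θ ⇒ A ⊃ B ∷ Δ ∣ Λₗ ++ Λᵣ
closeChild Λₗ Λᵣ (kax⊥ m) = kax⊥ m
closeChild Λₗ Λᵣ (kinit p m₁ m₂) = kinit p m₁ (there m₂)
closeChild Λₗ Λᵣ (k∧L m d) = k∧L m (closeChild Λₗ Λᵣ d)
closeChild Λₗ Λᵣ (k∧R m d₁ d₂) =
  k∧R (there m) (kmono (closeChild Λₗ Λᵣ d₁) ⊆.⊆-refl (⊆.⊆-reflexive-↭ (swap₂ _ _)) (≼*-refl _))
                (kmono (closeChild Λₗ Λᵣ d₂) ⊆.⊆-refl (⊆.⊆-reflexive-↭ (swap₂ _ _)) (≼*-refl _))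
closeChild Λₗ Λᵣ (k∨L m d₁ d₂) = k∨L m (closeChild Λₗ Λᵣ d₁) (closeChild Λₗ Λᵣ d₂)
closeChild Λₗ Λᵣ (k∨R m d) =
  k∨R (there m) (kmono (closeChild Λₗ Λᵣ d) ⊆.⊆-refl (⊆.⊆-reflexive-↭ (↭-sym (∷-under _ (∷-under _ ↭-refl))))
                       (≼*-refl _))
closeChild Λₗ Λᵣ (k⊃L m d₁ d₂) =
  k⊃L m (kmono (closeChild Λₗ Λᵣ d₁) ⊆.⊆-refl (⊆.⊆-reflexive-↭ (swap₂ _ _)) (≼*-refl _)) (closeChild Λₗ Λᵣ d₂)
closeChild Λₗ Λᵣ (k⊃R m d) = k⊃R (there m) d
closeChild {Θ} Λₗ Λᵣ (kopen m d) with ∈-++⁻ Λₗ m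
... | inj₁ m' = kopen (∈-++⁺ˡ m') d
... | inj₂ (here refl) = k⊃R (here refl) (kmono d (⊆.⊆-reflexive-↭ (↭-sym (∷↭∷ʳ _ Θ))) ⊆.⊆-refl (λ ()))
... | inj₂ (there m') = kopen (∈-++⁺ʳ Λₗ m') d

⊃Rᴷ : ∀ {Γ Δ Λ A B} → Rule₁ (nest Γ Δ (Λ ∷ʳ nest [ A ] [ B ] [])) (nest Γ (A ⊃ B ∷ Δ) Λ)
⊃Rᴷ {Λ = Λ} Σ' d = subst (K⊢ _ ⇒ _ ∣_) (++-identityʳ Λ) (closeChild Λ [] d)

liftChild : ∀ {Θ Δ A Γ' Δ' Λ'} Λₗ Λᵣ → A ∈ Θ →
            K⊢ Θ ⇒ Δ ∣ Λₗ ++ nest (A ∷ Γ') Δ' Λ' ∷ Λᵣ → K⊢ Θ ⇒ Δ ∣ Λₗ ++ nest Γ' Δ' Λ' ∷ Λᵣ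
liftChild {Λ' = Λ'} Λₗ Λᵣ a d =
  replaceChild Λₗ Λᵣ d (λ {Θ'} s e → kmono e (absorbAt Θ' (∈-++⁺ˡ (s a))) ⊆.⊆-refl (≼*-refl Λ'))

liftᴷ : ∀ {Γ Δ Λ Γ' Δ' Λ' A} →
        Rule₁ (nest (A ∷ Γ) Δ (Λ ∷ʳ nest (A ∷ Γ') Δ' Λ')) (nest (A ∷ Γ) Δ (Λ ∷ʳ nest Γ' Δ' Λ'))
liftᴷ {Λ = Λ} Σ' = liftChild Λ [] (∈-++⁺ʳ Σ' (here refl))

-- From NS to K

-- the contexts of NS are the paths that always descend into a last child
ctxPath : Ctx → Path
ctxPath hole = root
ctxPath (down Γ Δ Λ Υ) = step Γ Δ Λ [] (ctxPath Υ)

plug≡⟨⟩ : ∀ Υ N → plug Υ N ≡ ctxPath Υ ⟨ N ⟩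
plug≡⟨⟩ hole N = refl
plug≡⟨⟩ (down Γ Δ Λ Υ) N = cong (λ M → nest Γ Δ (Λ ∷ʳ M)) (plug≡⟨⟩ Υ N)

inCtx₀ : ∀ Υ {C} → Rule₀ C → K[ [] ]⊢ plug Υ C
inCtx₀ Υ {C} r rewrite plug≡⟨⟩ Υ C = deep₀ r (ctxPath Υ) []

inCtx₁ : ∀ Υ {P C} → Rule₁ P C → K[ [] ]⊢ plug Υ P → K[ [] ]⊢ plug Υ C
inCtx₁ Υ {P} {C} r rewrite plug≡⟨⟩ Υ P | plug≡⟨⟩ Υ C = deep₁ r (ctxPath Υ) []

inCtx₂ : ∀ Υ {P₁ P₂ C} → Rule₂ P₁ P₂ C → K[ [] ]⊢ plug Υ P₁ → K[ [] ]⊢ plug Υ P₂ → K[ [] ]⊢ plug Υ C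
inCtx₂ Υ {P₁} {P₂} {C} r rewrite plug≡⟨⟩ Υ P₁ | plug≡⟨⟩ Υ P₂ | plug≡⟨⟩ Υ C = deep₂ r (ctxPath Υ) []

≈⇒≼ : ∀ {N N'} → N ≈N N' → N ≼ N'
≈Λ⇒≼* : ∀ {Λ Λ'} → Λ ≈Λ Λ' → Λ ≼* Λ'
≈⇒≼ (nest≈ g e l) = cover (⊆.⊆-reflexive-↭ g) (⊆.⊆-reflexive-↭ e) (≈Λ⇒≼* l)
≈Λ⇒≼* [] ()
≈Λ⇒≼* (p ∷ l) (here refl) = _ , here refl , ≈⇒≼ p
≈Λ⇒≼* (p ∷ l) (there m) = let N' , m' , q = ≈Λ⇒≼* l m in N' , there m' , q
≈Λ⇒≼* swap (here refl) = _ , there (here refl) , ≼-refl _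
≈Λ⇒≼* swap (there (here refl)) = _ , here refl , ≼-refl _
≈Λ⇒≼* swap (there (there m)) = _ , there (there m) , ≼-refl _
≈Λ⇒≼* (trans l₁ l₂) m =
  let N' , m' , p = ≈Λ⇒≼* l₁ m ; N'' , m'' , q = ≈Λ⇒≼* l₂ m' in N'' , m'' , ≼-trans p q

NS⇒K : ∀ {N} → NS⊢ N → K[ [] ]⊢ N
NS⇒K (perm p d) = K-mono ⊆.⊆-refl (≈⇒≼ p) (NS⇒K d)
NS⇒K (ax⊥ {Υ}) = inCtx₀ Υ ⊥ᴷ
NS⇒K (init {Υ} p) = inCtx₀ Υ (idᴷ (atom p))
NS⇒K (∧L {Υ} d) = inCtx₁ Υ ∧Lᴷ (NS⇒K d)
NS⇒K (∧R {Υ} d₁ d₂) = inCtx₂ Υ ∧Rᴷ (NS⇒K d₁) (NS⇒K d₂)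
NS⇒K (∨L {Υ} d₁ d₂) = inCtx₂ Υ ∨Lᴷ (NS⇒K d₁) (NS⇒K d₂)
NS⇒K (∨R {Υ} d) = inCtx₁ Υ ∨Rᴷ (NS⇒K d)
NS⇒K (⊃L {Υ} d₁ d₂) = inCtx₂ Υ ⊃Lᴷ (NS⇒K d₁) (NS⇒K d₂)
NS⇒K (⊃R {Υ} d) = inCtx₁ Υ ⊃Rᴷ (NS⇒K d)
NS⇒K (lift {Υ} d) = inCtx₁ Υ liftᴷ (NS⇒K d)

-- From LNS to K
--
-- The linear nested sequent Γ₁ ⊢ Δ₁ // … // Γₙ ⊢ Δₙ is the nested sequent
-- Γ₁ ⊢ Δ₁, [ … [Γₙ ⊢ Δₙ] … ]; its last component sits at the end of the
-- path through the components before it.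

emb : List Seq → NSeq
emb [] = nest [] [] []
emb ((Γ , Δ) ∷ []) = nest Γ Δ []
emb ((Γ , Δ) ∷ s ∷ G) = nest Γ Δ [ emb (s ∷ G) ]

chain : List Seq → Path
chain [] = root
chain ((Γ , Δ) ∷ G) = step Γ Δ [] [] (chain G)

emb-last : ∀ G Γ Δ → emb (G ∷ʳ (Γ , Δ)) ≡ chain G ⟨ nest Γ Δ [] ⟩
emb-last [] Γ Δ = refl
emb-last ((Γ₁ , Δ₁) ∷ []) Γ Δ = refl
emb-last ((Γ₁ , Δ₁) ∷ s ∷ G) Γ Δ = cong (λ N → nest Γ₁ Δ₁ [ N ]) (emb-last (s ∷ G) Γ Δ)

chain-last : ∀ G Γ Δ N → chain (G ∷ʳ (Γ , Δ)) ⟨ N ⟩ ≡ chain G ⟨ nest Γ Δ [ N ] ⟩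
chain-last [] Γ Δ N = refl
chain-last ((Γ₁ , Δ₁) ∷ G) Γ Δ N = cong (λ M → nest Γ₁ Δ₁ [ M ]) (chain-last G Γ Δ N)

emb-last₂ : ∀ G Γ Δ Γ' Δ' → emb (G ∷ʳ (Γ , Δ) ∷ʳ (Γ' , Δ')) ≡ chain G ⟨ nest Γ Δ [ nest Γ' Δ' [] ] ⟩
emb-last₂ G Γ Δ Γ' Δ' = ≡.trans (emb-last (G ∷ʳ (Γ , Δ)) Γ' Δ') (chain-last G Γ Δ (nest Γ' Δ' []))

emb-≈ : ∀ {G G'} → G ≈L G' → emb G ≼ emb G'
emb-≈ [] = ≼-refl _
emb-≈ (seq≈ g e ∷ []) = cover (⊆.⊆-reflexive-↭ g) (⊆.⊆-reflexive-↭ e) (λ ())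
emb-≈ (seq≈ g e ∷ p@(_ ∷ _)) = cover (⊆.⊆-reflexive-↭ g) (⊆.⊆-reflexive-↭ e) (only (emb-≈ p))
  where only : ∀ {N N'} → N ≼ N' → [ N ] ≼* [ N' ]
        only N≼N' (here refl) = _ , here refl , N≼N'

K₀ : NSeq → Set
K₀ N = K[ [] ]⊢ N

liftᴸ : ∀ {A Γ Δ Γ' Δ'} → Rule₁ (nest Γ Δ [ nest (A ∷ Γ') Δ' [] ]) (nest (A ∷ Γ) Δ [ nest Γ' Δ' [] ])
liftᴸ {A} Σ' d = liftᴷ {Λ = []} Σ' (kmono d (⊆.++⁺ʳ Σ' (⊆.xs⊆x∷xs _ A)) ⊆.⊆-refl (≼*-refl _))

atLast₀ : ∀ G {Γ Δ} → Rule₀ (nest Γ Δ []) → K₀ (emb (G ∷ʳ (Γ , Δ)))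
atLast₀ G {Γ} {Δ} r rewrite emb-last G Γ Δ = deep₀ r (chain G) []

atLast₁ : ∀ G {Γ Δ Γ₁ Δ₁} → Rule₁ (nest Γ₁ Δ₁ []) (nest Γ Δ []) →
          K₀ (emb (G ∷ʳ (Γ₁ , Δ₁))) → K₀ (emb (G ∷ʳ (Γ , Δ)))
atLast₁ G {Γ} {Δ} {Γ₁} {Δ₁} r rewrite emb-last G Γ Δ | emb-last G Γ₁ Δ₁ = deep₁ r (chain G) []

atLast₂ : ∀ G {Γ Δ Γ₁ Δ₁ Γ₂ Δ₂} → Rule₂ (nest Γ₁ Δ₁ []) (nest Γ₂ Δ₂ []) (nest Γ Δ []) →
          K₀ (emb (G ∷ʳ (Γ₁ , Δ₁))) → K₀ (emb (G ∷ʳ (Γ₂ , Δ₂))) → K₀ (emb (G ∷ʳ (Γ , Δ)))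
atLast₂ G {Γ} {Δ} {Γ₁} {Δ₁} {Γ₂} {Δ₂} r
  rewrite emb-last G Γ Δ | emb-last G Γ₁ Δ₁ | emb-last G Γ₂ Δ₂ = deep₂ r (chain G) []

LNS⇒K : ∀ {G} → LNS⊢ G → K₀ (emb G)
LNS⇒K (perm p d) = K-mono ⊆.⊆-refl (emb-≈ p) (LNS⇒K d)
LNS⇒K (ax⊥ {G}) = atLast₀ G ⊥ᴷ
LNS⇒K (init {G} A) = atLast₀ G (idᴷ A)
LNS⇒K (∧L {G} d) = atLast₁ G ∧Lᴷ (LNS⇒K d)
LNS⇒K (∧R {G} d₁ d₂) = atLast₂ G ∧Rᴷ (LNS⇒K d₁) (LNS⇒K d₂)
LNS⇒K (∨L {G} d₁ d₂) = atLast₂ G ∨Lᴷ (LNS⇒K d₁) (LNS⇒K d₂)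
LNS⇒K (∨R {G} d) = atLast₁ G ∨Rᴷ (LNS⇒K d)
LNS⇒K (⊃L {G} d₁ d₂) = atLast₂ G ⊃Lᴷ (LNS⇒K d₁) (LNS⇒K d₂)
LNS⇒K (⊃R {G} {Γ} {Δ} {A} {B} d) =
  subst K₀ (sym (emb-last G Γ (A ⊃ B ∷ Δ)))
    (deep₁ ⊃Rᴷ (chain G) [] (subst K₀ (emb-last₂ G Γ Δ [ A ] [ B ]) (LNS⇒K d)))
LNS⇒K (lift {G} {Γ} {Δ} {Γ'} {Δ'} {A} d) =
  subst K₀ (sym (emb-last₂ G (A ∷ Γ) Δ Γ' Δ'))
    (deep₁ liftᴸ (chain G) [] (subst K₀ (emb-last₂ G Γ Δ (A ∷ Γ') Δ') (LNS⇒K d)))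

-- From mLJ to NS
--
-- For ⊃R the premise A, Γ ⊢ B is derived in a new last
-- child, into which Γ is then lifted from the parent.

≈N-refl : ∀ N → N ≈N N
≈Λ-refl : ∀ Λ → Λ ≈Λ Λ
≈N-refl (nest Γ Δ Λ) = nest≈ ↭-refl ↭-refl (≈Λ-refl Λ)
≈Λ-refl [] = []
≈Λ-refl (N ∷ Λ) = ≈N-refl N ∷ ≈Λ-refl Λ

≈Λ-∷ʳ : ∀ Λ {N N'} → N ≈N N' → (Λ ∷ʳ N) ≈Λ (Λ ∷ʳ N')
≈Λ-∷ʳ [] p = p ∷ []
≈Λ-∷ʳ (M ∷ Λ) p = ≈N-refl M ∷ ≈Λ-∷ʳ Λ p

plug-≈ : ∀ Υ {N N'} → N ≈N N' → plug Υ N ≈N plug Υ N'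
plug-≈ hole p = p
plug-≈ (down Γ Δ Λ Υ) p = nest≈ ↭-refl ↭-refl (≈Λ-∷ʳ Λ (plug-≈ Υ p))

extend : Ctx → List Fm → List Fm → List NSeq → Ctx
extend hole Γ Δ Λ = down Γ Δ Λ hole
extend (down Γ' Δ' Λ' Υ) Γ Δ Λ = down Γ' Δ' Λ' (extend Υ Γ Δ Λ)

plug-extend : ∀ Υ Γ Δ Λ M → plug (extend Υ Γ Δ Λ) M ≡ plug Υ (nest Γ Δ (Λ ∷ʳ M))
plug-extend hole Γ Δ Λ M = refl
plug-extend (down Γ' Δ' Λ' Υ) Γ Δ Λ M = cong (λ N → nest Γ' Δ' (Λ' ∷ʳ N)) (plug-extend Υ Γ Δ Λ M)

liftFrom : ∀ Υ {Γ Δ Λ Ψ Δ' Λ' A} → A ∈ Γ →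
           NS⊢ plug Υ (nest Γ Δ (Λ ∷ʳ nest (A ∷ Ψ) Δ' Λ')) → NS⊢ plug Υ (nest Γ Δ (Λ ∷ʳ nest Ψ Δ' Λ'))
liftFrom Υ A∈Γ d with ∈⇒↭∷ A∈Γ
... | _ , g = reorder (↭-sym g) (lift (reorder g d))
  where reorder : ∀ {Γ₁ Γ₂ Δ Λ} → Γ₁ ↭ Γ₂ → NS⊢ plug Υ (nest Γ₁ Δ Λ) → NS⊢ plug Υ (nest Γ₂ Δ Λ)
        reorder g = perm (plug-≈ Υ (nest≈ g ↭-refl (≈Λ-refl _)))

liftAllFrom : ∀ Υ {Γ Δ Λ Ψ Δ' Λ'} Γs → Γs ⊆ Γ →
              NS⊢ plug Υ (nest Γ Δ (Λ ∷ʳ nest (Γs ++ Ψ) Δ' Λ')) → NS⊢ plug Υ (nest Γ Δ (Λ ∷ʳ nest Ψ Δ' Λ'))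
liftAllFrom Υ [] s d = d
liftAllFrom Υ (C ∷ Γs) s d = liftAllFrom Υ Γs (λ m → s (there m)) (liftFrom Υ (s (here refl)) d)

mLJ⇒NS : ∀ {Γ Δ} → mLJ⊢ Γ ⇒ Δ → ∀ Υ Λ → NS⊢ plug Υ (nest Γ Δ Λ)
mLJ⇒NS (perm g e d) Υ Λ = perm (plug-≈ Υ (nest≈ g e (≈Λ-refl Λ))) (mLJ⇒NS d Υ Λ)
mLJ⇒NS ax⊥ Υ Λ = ax⊥ {Υ}
mLJ⇒NS (init p) Υ Λ = init {Υ} p
mLJ⇒NS (∧L d) Υ Λ = ∧L {Υ} (mLJ⇒NS d Υ Λ)
mLJ⇒NS (∧R d₁ d₂) Υ Λ = ∧R {Υ} (mLJ⇒NS d₁ Υ Λ) (mLJ⇒NS d₂ Υ Λ)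
mLJ⇒NS (∨L d₁ d₂) Υ Λ = ∨L {Υ} (mLJ⇒NS d₁ Υ Λ) (mLJ⇒NS d₂ Υ Λ)
mLJ⇒NS (∨R d) Υ Λ = ∨R {Υ} (mLJ⇒NS d Υ Λ)
mLJ⇒NS (⊃L d₁ d₂) Υ Λ = ⊃L {Υ} (mLJ⇒NS d₁ Υ Λ) (mLJ⇒NS d₂ Υ Λ)
mLJ⇒NS {Γ} {_ ⊃ _ ∷ Δ} (⊃R {A = A} {B} d) Υ Λ =
  ⊃R {Υ} (liftAllFrom Υ Γ ⊆.⊆-refl
    (perm (plug-≈ Υ (nest≈ ↭-refl ↭-refl (≈Λ-∷ʳ Λ (nest≈ (∷↭∷ʳ A Γ) ↭-refl []))))
      (subst NS⊢_ (plug-extend Υ Γ Δ Λ _) (mLJ⇒NS d (extend Υ Γ Δ Λ) []))))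

-- From mLJ to LNS
--
-- As for NS; the lift rule of LNS moves a formula from the new last
-- component into the previous one, which starts out empty.

≈S-refl : ∀ s → s ≈S s
≈S-refl (Γ , Δ) = seq≈ ↭-refl ↭-refl

≈L-∷ʳ : ∀ G {s s'} → s ≈S s' → (G ∷ʳ s) ≈L (G ∷ʳ s')
≈L-∷ʳ [] p = p ∷ []
≈L-∷ʳ (t ∷ G) p = ≈S-refl t ∷ ≈L-∷ʳ G p

≈L-∷ʳ₂ : ∀ G {s s' t t'} → s ≈S s' → t ≈S t' → (G ∷ʳ s ∷ʳ t) ≈L (G ∷ʳ s' ∷ʳ t')
≈L-∷ʳ₂ [] p q = p ∷ q ∷ []
≈L-∷ʳ₂ (u ∷ G) p q = ≈S-refl u ∷ ≈L-∷ʳ₂ G p q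

liftAllᴸ : ∀ G Γ₀ Δ Γs Ψ Δ' → LNS⊢ (G ∷ʳ (Γ₀ , Δ) ∷ʳ (Γs ++ Ψ , Δ')) → LNS⊢ (G ∷ʳ (Γs ++ Γ₀ , Δ) ∷ʳ (Ψ , Δ'))
liftAllᴸ G Γ₀ Δ [] Ψ Δ' d = d
liftAllᴸ G Γ₀ Δ (C ∷ Γs) Ψ Δ' d =
  lift (liftAllᴸ G Γ₀ Δ Γs (C ∷ Ψ) Δ' (perm (≈L-∷ʳ (G ∷ʳ (Γ₀ , Δ)) (seq≈ (↭-sym (shift C Γs Ψ)) ↭-refl)) d))

mLJ⇒LNS : ∀ {Γ Δ} → mLJ⊢ Γ ⇒ Δ → ∀ G → LNS⊢ (G ∷ʳ (Γ , Δ))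
mLJ⇒LNS (perm g e d) G = perm (≈L-∷ʳ G (seq≈ g e)) (mLJ⇒LNS d G)
mLJ⇒LNS ax⊥ G = ax⊥ {G}
mLJ⇒LNS (init p) G = init {G} (atom p)
mLJ⇒LNS (∧L d) G = ∧L {G} (mLJ⇒LNS d G)
mLJ⇒LNS (∧R d₁ d₂) G = ∧R {G} (mLJ⇒LNS d₁ G) (mLJ⇒LNS d₂ G)
mLJ⇒LNS (∨L d₁ d₂) G = ∨L {G} (mLJ⇒LNS d₁ G) (mLJ⇒LNS d₂ G)
mLJ⇒LNS (∨R d) G = ∨R {G} (mLJ⇒LNS d G)
mLJ⇒LNS (⊃L d₁ d₂) G = ⊃L {G} (mLJ⇒LNS d₁ G) (mLJ⇒LNS d₂ G)
mLJ⇒LNS {Γ} {_ ⊃ _ ∷ Δ} (⊃R {A = A} {B} d) G =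
  ⊃R {G} (perm (≈L-∷ʳ₂ G (seq≈ (↭-reflexive (++-identityʳ Γ)) ↭-refl) (≈S-refl _))
    (liftAllᴸ G [] Δ Γ [ A ] [ B ]
      (perm (≈L-∷ʳ (G ∷ʳ ([] , Δ)) (seq≈ (∷↭∷ʳ A Γ) ↭-refl)) (mLJ⇒LNS d (G ∷ʳ ([] , Δ))))))

-- From mLJ to LbNS
--
-- An mLJ-derivation of Γ ⇒ Δ yields ℛ, x:Γ, X ⊢ x:Δ, Y for every x, ℛ,
-- X, Y.  For ⊃R a label y above all labels in use is fresh.

freshFor : ℕ → List Rel → List LFm → List LFm → ℕ
freshFor x ℛ X Y = suc (max 0 (x ∷ map proj₁ ℛ ++ map proj₂ ℛ ++ map proj₁ X ++ map proj₁ Y))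

freshFor-fresh : ∀ x ℛ X Y → Fresh (freshFor x ℛ X Y) x ℛ X Y
freshFor-fresh x ℛ X Y =
  let sources≤ , targets≤ , X≤ , Y≤ = split (map proj₁ ℛ) (map proj₂ ℛ) (map proj₁ X) (All.tail bounds)
  in (λ e → below (All.head bounds) (sym e)) ,
     All.zipWith (λ (s≤ , t≤) → below s≤ , below t≤) (AllP.map⁻ sources≤ , AllP.map⁻ targets≤) ,
     All.map below (AllP.map⁻ X≤) , All.map below (AllP.map⁻ Y≤)
  where
  labelsInUse = x ∷ map proj₁ ℛ ++ map proj₂ ℛ ++ map proj₁ X ++ map proj₁ Y
  bounds : All (_≤ max 0 labelsInUse) labelsInUse
  bounds = xs≤max 0 labelsInUse
  below : ∀ {a m} → a ≤ m → a ≢ suc m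
  below a≤m refl = <-irrefl refl a≤m
  split : ∀ {P : ℕ → Set} as bs cs {ds} → All P (as ++ bs ++ cs ++ ds) →
          All P as × All P bs × All P cs × All P ds
  split as bs cs ps =
    let pas , ps₁ = AllP.++⁻ as ps ; pbs , ps₂ = AllP.++⁻ bs ps₁ ; pcs , pds = AllP.++⁻ cs ps₂
    in pas , pbs , pcs , pds

liftAllᴸᵇ : ∀ {ℛ V W x y} Γs → All (λ C → (x , C) ∈ V) Γs →
            LbNS⊢ (x , y) ∷ ℛ ∣ y ∶ Γs ++ V ⇒ W → LbNS⊢ (x , y) ∷ ℛ ∣ V ⇒ W
liftAllᴸᵇ [] [] d = d
liftAllᴸᵇ {y = y} (C ∷ Γs) (C∈V ∷ Γs∈V) d = liftAllᴸᵇ Γs Γs∈V (liftOne (∈-++⁺ʳ (y ∶ Γs) C∈V) d)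
  where liftOne : ∀ {ℛ V W x y C} → (x , C) ∈ V →
                  LbNS⊢ (x , y) ∷ ℛ ∣ (y , C) ∷ V ⇒ W → LbNS⊢ (x , y) ∷ ℛ ∣ V ⇒ W
        liftOne {y = y} {C} m d with ∈⇒↭∷ m
        ... | _ , g = perm ↭-refl (↭-sym g) ↭-refl (lift (perm ↭-refl (∷-under (y , C) g) ↭-refl d))

mLJ⇒LbNS : ∀ {Γ Δ} → mLJ⊢ Γ ⇒ Δ → ∀ ℛ X Y x → LbNS⊢ ℛ ∣ x ∶ Γ ++ X ⇒ x ∶ Δ ++ Y
mLJ⇒LbNS (perm g e d) ℛ X Y x = perm ↭-refl (++⁺ʳ X (map⁺ _ g)) (++⁺ʳ Y (map⁺ _ e)) (mLJ⇒LbNS d ℛ X Y x)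
mLJ⇒LbNS ax⊥ ℛ X Y x = ax⊥
mLJ⇒LbNS (init p) ℛ X Y x = init p
mLJ⇒LbNS (∧L d) ℛ X Y x = ∧L (mLJ⇒LbNS d ℛ X Y x)
mLJ⇒LbNS (∧R d₁ d₂) ℛ X Y x = ∧R (mLJ⇒LbNS d₁ ℛ X Y x) (mLJ⇒LbNS d₂ ℛ X Y x)
mLJ⇒LbNS (∨L d₁ d₂) ℛ X Y x = ∨L (mLJ⇒LbNS d₁ ℛ X Y x) (mLJ⇒LbNS d₂ ℛ X Y x)
mLJ⇒LbNS (∨R d) ℛ X Y x = ∨R (mLJ⇒LbNS d ℛ X Y x)
mLJ⇒LbNS (⊃L d₁ d₂) ℛ X Y x = ⊃L (mLJ⇒LbNS d₁ ℛ X Y x) (mLJ⇒LbNS d₂ ℛ X Y x)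
mLJ⇒LbNS {Γ} {_ ⊃ _ ∷ Δ} (⊃R {A = A} {B} d) ℛ X Y x =
  ⊃R (freshFor-fresh x ℛ X' Y')
    (liftAllᴸᵇ Γ (All.tabulate (λ m → there (∈-++⁺ˡ (∈-map⁺ (λ C → (x , C)) m))))
      (perm ↭-refl (↭-sym (shift (y , A) (y ∶ Γ) X')) ↭-refl (mLJ⇒LbNS d ((x , y) ∷ ℛ) X' Y' y)))
  where X' = x ∶ Γ ++ X
        Y' = x ∶ Δ ++ Y
        y = freshFor x ℛ X' Y'

-- Labelled trees
--
-- The LbNS-sequents reachable from x:Γ ⊢ x:Δ are tree-shaped.  They are
-- represented by trees whose nodes carry a state variable and the formulae
-- labelled with it; erasing the labels gives a nested sequent.

data LTree : Set where
  node : ℕ → List Fm → List Fm → List LTree → LTree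

label : LTree → ℕ
label (node x _ _ _) = x

erase : LTree → NSeq
erase* : List LTree → List NSeq
erase (node x Γ Δ Λ) = nest Γ Δ (erase* Λ)
erase* [] = []
erase* (c ∷ Λ) = erase c ∷ erase* Λ

data LPath : Set where
  top  : LPath
  into : ℕ → List Fm → List Fm → List LTree → List LTree → LPath → LPath

_⟪_⟫ : LPath → LTree → LTree
top ⟪ M ⟫ = M
into x Γ Δ Λₗ Λᵣ π ⟪ M ⟫ = node x Γ Δ (Λₗ ++ π ⟪ M ⟫ ∷ Λᵣ)

erasePath : LPath → Path
erasePath top = root
erasePath (into x Γ Δ Λₗ Λᵣ π) = step Γ Δ (erase* Λₗ) (erase* Λᵣ) (erasePath π)

_⊙_ : LPath → LPath → LPath
top ⊙ π' = π'
into x Γ Δ Λₗ Λᵣ π ⊙ π' = into x Γ Δ Λₗ Λᵣ (π ⊙ π')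

⊙-⟪⟫ : ∀ π π' M → (π ⊙ π') ⟪ M ⟫ ≡ π ⟪ π' ⟪ M ⟫ ⟫
⊙-⟪⟫ top π' M = refl
⊙-⟪⟫ (into x Γ Δ Λₗ Λᵣ π) π' M = cong (λ N → node x Γ Δ (Λₗ ++ N ∷ Λᵣ)) (⊙-⟪⟫ π π' M)

erase*-mid : ∀ Λₗ c Λᵣ → erase* (Λₗ ++ c ∷ Λᵣ) ≡ erase* Λₗ ++ erase c ∷ erase* Λᵣ
erase*-mid [] c Λᵣ = refl
erase*-mid (c' ∷ Λₗ) c Λᵣ = cong (erase c' ∷_) (erase*-mid Λₗ c Λᵣ)

erase*-∷ʳ : ∀ Λ c → erase* (Λ ∷ʳ c) ≡ erase* Λ ∷ʳ erase c
erase*-∷ʳ Λ c = erase*-mid Λ c []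

erase-⟪⟫ : ∀ π M → erase (π ⟪ M ⟫) ≡ erasePath π ⟨ erase M ⟩
erase-⟪⟫ top M = refl
erase-⟪⟫ (into x Γ Δ Λₗ Λᵣ π) M =
  ≡.trans (cong (nest Γ Δ) (erase*-mid Λₗ (π ⟪ M ⟫) Λᵣ))
          (cong (λ N → nest Γ Δ (erase* Λₗ ++ N ∷ erase* Λᵣ)) (erase-⟪⟫ π M))

label-⟪⟫ : ∀ π {M M'} → label M ≡ label M' → label (π ⟪ M ⟫) ≡ label (π ⟪ M' ⟫)
label-⟪⟫ top e = e
label-⟪⟫ (into x Γ Δ Λₗ Λᵣ π) e = refl

module Collect {B : Set} (at : ℕ → List Fm → List Fm → List B) where

  collect : LTree → List B
  collect* : List LTree → List B
  collect (node x Γ Δ Λ) = at x Γ Δ ++ collect* Λ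
  collect* [] = []
  collect* (c ∷ Λ) = collect c ++ collect* Λ

  collect*-mid : ∀ Λₗ c Λᵣ → collect* (Λₗ ++ c ∷ Λᵣ) ≡ collect* Λₗ ++ collect c ++ collect* Λᵣ
  collect*-mid [] c Λᵣ = refl
  collect*-mid (c' ∷ Λₗ) c Λᵣ =
    ≡.trans (cong (collect c' ++_) (collect*-mid Λₗ c Λᵣ)) (sym (++-assoc (collect c') (collect* Λₗ) _))

  ∈-collect*-mid⁻ : ∀ {b} Λₗ c Λᵣ → b ∈ collect* (Λₗ ++ c ∷ Λᵣ) →
                    b ∈ collect* Λₗ ⊎ b ∈ collect c ⊎ b ∈ collect* Λᵣ
  ∈-collect*-mid⁻ Λₗ c Λᵣ m with ∈-++⁻ (collect* Λₗ) (subst (_ ∈_) (collect*-mid Λₗ c Λᵣ) m)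
  ... | inj₁ m' = inj₁ m'
  ... | inj₂ m' = inj₂ (∈-++⁻ (collect c) m')

  ∈-collect*-mid⁺ : ∀ {b} Λₗ c Λᵣ → b ∈ collect* Λₗ ⊎ b ∈ collect c ⊎ b ∈ collect* Λᵣ →
                    b ∈ collect* (Λₗ ++ c ∷ Λᵣ)
  ∈-collect*-mid⁺ {b} Λₗ c Λᵣ m = subst (_ ∈_) (sym (collect*-mid Λₗ c Λᵣ)) (place m)
    where place : b ∈ collect* Λₗ ⊎ b ∈ collect c ⊎ b ∈ collect* Λᵣ → b ∈ collect* Λₗ ++ collect c ++ collect* Λᵣ
          place (inj₁ m') = ∈-++⁺ˡ m'
          place (inj₂ (inj₁ m')) = ∈-++⁺ʳ (collect* Λₗ) (∈-++⁺ˡ m')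
          place (inj₂ (inj₂ m')) = ∈-++⁺ʳ (collect* Λₗ) (∈-++⁺ʳ (collect c) m')

  collect-⟪⟫⁺ : ∀ π {M b} → b ∈ collect M → b ∈ collect (π ⟪ M ⟫)
  collect-⟪⟫⁺ top m = m
  collect-⟪⟫⁺ (into x Γ Δ Λₗ Λᵣ π) {M} m =
    ∈-++⁺ʳ (at x Γ Δ) (∈-collect*-mid⁺ Λₗ (π ⟪ M ⟫) Λᵣ (inj₂ (inj₁ (collect-⟪⟫⁺ π m))))

  collect-⟪⟫-⊆ : ∀ π {M M'} e → collect M ⊆ e ++ collect M' → collect (π ⟪ M ⟫) ⊆ e ++ collect (π ⟪ M' ⟫)
  collect-⟪⟫-⊆ top e s = s
  collect-⟪⟫-⊆ (into x Γ Δ Λₗ Λᵣ π) {M} {M'} e s m with ∈-++⁻ (at x Γ Δ) m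
  ... | inj₁ m' = ∈-++⁺ʳ e (∈-++⁺ˡ m')
  ... | inj₂ m' with ∈-collect*-mid⁻ Λₗ (π ⟪ M ⟫) Λᵣ m'
  ... | inj₁ k = ∈-++⁺ʳ e (∈-++⁺ʳ (at x Γ Δ) (∈-collect*-mid⁺ Λₗ (π ⟪ M' ⟫) Λᵣ (inj₁ k)))
  ... | inj₂ (inj₂ k) = ∈-++⁺ʳ e (∈-++⁺ʳ (at x Γ Δ) (∈-collect*-mid⁺ Λₗ (π ⟪ M' ⟫) Λᵣ (inj₂ (inj₂ k))))
  ... | inj₂ (inj₁ k) with ∈-++⁻ e (collect-⟪⟫-⊆ π e s k)
  ... | inj₁ k' = ∈-++⁺ˡ k'
  ... | inj₂ k' = ∈-++⁺ʳ e (∈-++⁺ʳ (at x Γ Δ) (∈-collect*-mid⁺ Λₗ (π ⟪ M' ⟫) Λᵣ (inj₂ (inj₁ k'))))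

  collect-⟪⟫-↭ : ∀ π {M M'} e → collect M' ↭ e ++ collect M → collect (π ⟪ M' ⟫) ↭ e ++ collect (π ⟪ M ⟫)
  collect-⟪⟫-↭ top e p = p
  collect-⟪⟫-↭ (into x Γ Δ Λₗ Λᵣ π) {M} {M'} e p = begin
    at x Γ Δ ++ collect* (Λₗ ++ π ⟪ M' ⟫ ∷ Λᵣ)         ≡⟨ cong (at x Γ Δ ++_) (collect*-mid Λₗ _ Λᵣ) ⟩
    O ++ Lₗ ++ collect (π ⟪ M' ⟫) ++ Lᵣ                ↭⟨ ++⁺ˡ O (++⁺ˡ Lₗ (++⁺ʳ Lᵣ (collect-⟪⟫-↭ π e p))) ⟩
    O ++ Lₗ ++ (e ++ collect (π ⟪ M ⟫)) ++ Lᵣ          ≡⟨ reassoc ⟩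
    (O ++ Lₗ) ++ e ++ collect (π ⟪ M ⟫) ++ Lᵣ          ↭⟨ shifts (O ++ Lₗ) e ⟩
    e ++ (O ++ Lₗ) ++ collect (π ⟪ M ⟫) ++ Lᵣ          ≡⟨ cong (e ++_) (++-assoc O Lₗ _) ⟩
    e ++ O ++ Lₗ ++ collect (π ⟪ M ⟫) ++ Lᵣ            ≡⟨ cong (λ L → e ++ O ++ L) (sym (collect*-mid Λₗ _ Λᵣ)) ⟩
    e ++ at x Γ Δ ++ collect* (Λₗ ++ π ⟪ M ⟫ ∷ Λᵣ)     ∎
    where
    open PermutationReasoning
    O = at x Γ Δ
    Lₗ = collect* Λₗ
    Lᵣ = collect* Λᵣ
    reassoc : O ++ Lₗ ++ (e ++ collect (π ⟪ M ⟫)) ++ Lᵣ ≡ (O ++ Lₗ) ++ e ++ collect (π ⟪ M ⟫) ++ Lᵣ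
    reassoc = ≡.trans (sym (++-assoc O Lₗ _)) (cong ((O ++ Lₗ) ++_) (++-assoc e (collect (π ⟪ M ⟫)) Lᵣ))

open Collect using (collect; collect*)

labelAt : ℕ → List Fm → List Fm → List ℕ
labelAt x _ _ = [ x ]

labels : LTree → List ℕ
labels = collect labelAt

labels* : List LTree → List ℕ
labels* = collect* labelAt

Side : Set
Side = List Fm → List Fm → List Fm

left right : Side
left Γ Δ = Γ
right Γ Δ = Δ

formulaeAt : Side → ℕ → List Fm → List Fm → List LFm
formulaeAt side x Γ Δ = x ∶ side Γ Δ

formulae : Side → LTree → List LFm
formulae side = collect (formulaeAt side)

edges : LTree → List Rel
edges* : ℕ → List LTree → List Rel
edges (node x Γ Δ Λ) = edges* x Λ
edges* x [] = []
edges* x (c ∷ Λ) = ((x , label c) ∷ edges c) ++ edges* x Λ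

edges*-mid : ∀ x Λₗ c Λᵣ → edges* x (Λₗ ++ c ∷ Λᵣ) ≡ edges* x Λₗ ++ ((x , label c) ∷ edges c) ++ edges* x Λᵣ
edges*-mid x [] c Λᵣ = refl
edges*-mid x (c' ∷ Λₗ) c Λᵣ =
  ≡.trans (cong (((x , label c') ∷ edges c') ++_) (edges*-mid x Λₗ c Λᵣ))
          (sym (++-assoc ((x , label c') ∷ edges c') (edges* x Λₗ) _))

∈-edges*-mid⁺ : ∀ {r} x Λₗ c Λᵣ → r ∈ edges* x Λₗ ⊎ r ∈ (x , label c) ∷ edges c ⊎ r ∈ edges* x Λᵣ →
                r ∈ edges* x (Λₗ ++ c ∷ Λᵣ)
∈-edges*-mid⁺ {r} x Λₗ c Λᵣ m = subst (_ ∈_) (sym (edges*-mid x Λₗ c Λᵣ)) (place m)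
  where place : r ∈ edges* x Λₗ ⊎ r ∈ (x , label c) ∷ edges c ⊎ r ∈ edges* x Λᵣ →
                r ∈ edges* x Λₗ ++ ((x , label c) ∷ edges c) ++ edges* x Λᵣ
        place (inj₁ m') = ∈-++⁺ˡ m'
        place (inj₂ (inj₁ m')) = ∈-++⁺ʳ (edges* x Λₗ) (∈-++⁺ˡ m')
        place (inj₂ (inj₂ m')) = ∈-++⁺ʳ (edges* x Λₗ) (∈-++⁺ʳ ((x , label c) ∷ edges c) m')

∈-edges*-mid⁻ : ∀ {r} x Λₗ c Λᵣ → r ∈ edges* x (Λₗ ++ c ∷ Λᵣ) →
                r ∈ edges* x Λₗ ⊎ r ∈ (x , label c) ∷ edges c ⊎ r ∈ edges* x Λᵣ
∈-edges*-mid⁻ x Λₗ c Λᵣ m with ∈-++⁻ (edges* x Λₗ) (subst (_ ∈_) (edges*-mid x Λₗ c Λᵣ) m)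
... | inj₁ m' = inj₁ m'
... | inj₂ m' = inj₂ (∈-++⁻ ((x , label c) ∷ edges c) m')

edges-⟪⟫⁺ : ∀ π {M} → edges M ⊆ edges (π ⟪ M ⟫)
edges-⟪⟫⁺ top m = m
edges-⟪⟫⁺ (into x Γ Δ Λₗ Λᵣ π) {M} m = ∈-edges*-mid⁺ x Λₗ (π ⟪ M ⟫) Λᵣ (inj₂ (inj₁ (there (edges-⟪⟫⁺ π m))))

edges-⟪⟫-⊆ : ∀ π {M M'} e → label M ≡ label M' → edges M ⊆ e ++ edges M' →
             edges (π ⟪ M ⟫) ⊆ e ++ edges (π ⟪ M' ⟫)
edges-⟪⟫-⊆ top e r s = s
edges-⟪⟫-⊆ (into x Γ Δ Λₗ Λᵣ π) {M} {M'} e r s m with ∈-edges*-mid⁻ x Λₗ (π ⟪ M ⟫) Λᵣ m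
... | inj₁ k = ∈-++⁺ʳ e (∈-edges*-mid⁺ x Λₗ (π ⟪ M' ⟫) Λᵣ (inj₁ k))
... | inj₂ (inj₂ k) = ∈-++⁺ʳ e (∈-edges*-mid⁺ x Λₗ (π ⟪ M' ⟫) Λᵣ (inj₂ (inj₂ k)))
... | inj₂ (inj₁ (here refl)) =
  ∈-++⁺ʳ e (∈-edges*-mid⁺ x Λₗ (π ⟪ M' ⟫) Λᵣ (inj₂ (inj₁ (here (cong (x ,_) (label-⟪⟫ π r))))))
... | inj₂ (inj₁ (there k)) with ∈-++⁻ e (edges-⟪⟫-⊆ π e r s k)
... | inj₁ k' = ∈-++⁺ˡ k'
... | inj₂ k' = ∈-++⁺ʳ e (∈-edges*-mid⁺ x Λₗ (π ⟪ M' ⟫) Λᵣ (inj₂ (inj₁ (there k'))))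

Unique-↭ : ∀ {xs ys : List ℕ} → xs ↭ ys → Unique xs → Unique ys
Unique-↭ p = Unique-resp-↭ (≡.setoid ℕ) (↭⇒↭ₛ p)

Unique-++⁻ : ∀ (xs : List ℕ) {ys} → Unique (xs ++ ys) → Unique xs × Unique ys × (∀ {a} → a ∈ xs → a ∉ ys)
Unique-++⁻ [] u = [] , u , λ ()
Unique-++⁻ (x ∷ xs) (x≢ ∷ u) with Unique-++⁻ xs u
... | uxs , uys , disjoint = AllP.++⁻ˡ xs x≢ ∷ uxs , uys , λ
  { (here refl) m → All.lookup (AllP.++⁻ʳ xs x≢) m refl
  ; (there a∈xs) m → disjoint a∈xs m }

data NodeAt (z : ℕ) (N : LTree) : Set where
  nodeAt : ∀ π Γ Δ Λ → N ≡ π ⟪ node z Γ Δ Λ ⟫ → NodeAt z N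

data EdgeAt (x y : ℕ) (N : LTree) : Set where
  edgeAt : ∀ π Γ Δ Λₗ c Λᵣ → N ≡ π ⟪ node x Γ Δ (Λₗ ++ c ∷ Λᵣ) ⟫ → label c ≡ y → EdgeAt x y N

private
  data NodeAt* (z : ℕ) (Λ : List LTree) : Set where
    nodeAt* : ∀ Λₗ π Γ Δ Λ' Λᵣ → Λ ≡ Λₗ ++ π ⟪ node z Γ Δ Λ' ⟫ ∷ Λᵣ → NodeAt* z Λ

  data EdgeAt* (x y r : ℕ) (Λ : List LTree) : Set where
    direct : ∀ Λₗ c Λᵣ → r ≡ x → Λ ≡ Λₗ ++ c ∷ Λᵣ → label c ≡ y → EdgeAt* x y r Λ
    deeper : ∀ Λₗ Λᵣ π Γ Δ Λ₁ c Λ₂ → Λ ≡ Λₗ ++ π ⟪ node x Γ Δ (Λ₁ ++ c ∷ Λ₂) ⟫ ∷ Λᵣ → label c ≡ y →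
             EdgeAt* x y r Λ

findNode : ∀ {z} N → z ∈ labels N → NodeAt z N
findNode* : ∀ {z} Λ → z ∈ labels* Λ → NodeAt* z Λ
findNode (node x Γ Δ Λ) (here refl) = nodeAt top Γ Δ Λ refl
findNode (node x Γ Δ Λ) (there m) with findNode* Λ m
... | nodeAt* Λₗ π Γ' Δ' Λ' Λᵣ eq = nodeAt (into x Γ Δ Λₗ Λᵣ π) Γ' Δ' Λ' (cong (node x Γ Δ) eq)
findNode* (c ∷ Λ) m with ∈-++⁻ (labels c) m
... | inj₁ m' with findNode c m'
... | nodeAt π Γ Δ Λ' eq = nodeAt* [] π Γ Δ Λ' Λ (cong (_∷ Λ) eq)
findNode* (c ∷ Λ) m | inj₂ m' with findNode* Λ m'
... | nodeAt* Λₗ π Γ Δ Λ' Λᵣ eq = nodeAt* (c ∷ Λₗ) π Γ Δ Λ' Λᵣ (cong (c ∷_) eq)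

findEdge : ∀ {x y} N → (x , y) ∈ edges N → EdgeAt x y N
findEdge* : ∀ {x y} r Λ → (x , y) ∈ edges* r Λ → EdgeAt* x y r Λ
findEdge (node r Γ Δ Λ) m with findEdge* r Λ m
... | direct Λₗ c Λᵣ refl eq e = edgeAt top Γ Δ Λₗ c Λᵣ (cong (node r Γ Δ) eq) e
... | deeper Λₗ Λᵣ π Γ' Δ' Λ₁ c Λ₂ eq e = edgeAt (into r Γ Δ Λₗ Λᵣ π) Γ' Δ' Λ₁ c Λ₂ (cong (node r Γ Δ) eq) e
findEdge* r (c ∷ Λ) (here refl) = direct [] c Λ refl refl refl
findEdge* r (c ∷ Λ) (there m) with ∈-++⁻ (edges c) m
... | inj₁ m' with findEdge c m'
... | edgeAt π Γ Δ Λ₁ c' Λ₂ eq e = deeper [] Λ π Γ Δ Λ₁ c' Λ₂ (cong (_∷ Λ) eq) e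
findEdge* r (c ∷ Λ) (there m) | inj₂ m' with findEdge* r Λ m'
... | direct Λₗ c' Λᵣ e₁ eq e = direct (c ∷ Λₗ) c' Λᵣ e₁ (cong (c ∷_) eq) e
... | deeper Λₗ Λᵣ π Γ Δ Λ₁ c' Λ₂ eq e = deeper (c ∷ Λₗ) Λᵣ π Γ Δ Λ₁ c' Λ₂ (cong (c ∷_) eq) e

module _ (side : Side) where

  formula⇒label : ∀ {a φ} N → (a , φ) ∈ formulae side N → a ∈ labels N
  formula⇒label* : ∀ {a φ} Λ → (a , φ) ∈ collect* (formulaeAt side) Λ → a ∈ labels* Λ
  formula⇒label (node x Γ Δ Λ) m with ∈-++⁻ (x ∶ side Γ Δ) m
  ... | inj₁ m' with ∈-map⁻ (λ A → (x , A)) m'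
  ... | _ , _ , refl = here refl
  formula⇒label (node x Γ Δ Λ) m | inj₂ m' = there (formula⇒label* Λ m')
  formula⇒label* (c ∷ Λ) m with ∈-++⁻ (formulae side c) m
  ... | inj₁ m' = ∈-++⁺ˡ (formula⇒label c m')
  ... | inj₂ m' = ∈-++⁺ʳ (labels c) (formula⇒label* Λ m')

  formulaAtNode : ∀ π {z Γ Δ Λ φ} → Unique (labels (π ⟪ node z Γ Δ Λ ⟫)) →
                  (z , φ) ∈ formulae side (π ⟪ node z Γ Δ Λ ⟫) → φ ∈ side Γ Δ
  formulaAtNode top {z} {Γ} {Δ} {Λ} (z≢ ∷ _) m with ∈-++⁻ (z ∶ side Γ Δ) m
  ... | inj₁ m' with ∈-map⁻ (λ A → (z , A)) m'
  ... | _ , φ∈ , refl = φ∈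
  formulaAtNode top {Λ = Λ} (z≢ ∷ _) m | inj₂ m' = ⊥-elim (All.lookup z≢ (formula⇒label* Λ m') refl)
  formulaAtNode (into x Γ' Δ' Λₗ Λᵣ π) {z} {Γ} {Δ} {Λ} (x≢ ∷ u) m
    with Unique-++⁻ (labels* Λₗ) (subst Unique (Collect.collect*-mid labelAt Λₗ (π ⟪ node z Γ Δ Λ ⟫) Λᵣ) u)
  ... | _ , u' , disjointₗ with Unique-++⁻ (labels (π ⟪ node z Γ Δ Λ ⟫)) u'
  ... | uM , _ , disjointᵣ with ∈-++⁻ (x ∶ side Γ' Δ') m
  ... | inj₁ m' with ∈-map⁻ (λ A → (x , A)) m'
  ... | _ , _ , refl = ⊥-elim (All.lookup x≢ z∈rest refl)
    where z∈rest : z ∈ labels* (Λₗ ++ π ⟪ node z Γ Δ Λ ⟫ ∷ Λᵣ)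
          z∈rest = Collect.∈-collect*-mid⁺ labelAt Λₗ (π ⟪ node z Γ Δ Λ ⟫) Λᵣ
                     (inj₂ (inj₁ (Collect.collect-⟪⟫⁺ labelAt π (here refl))))
  formulaAtNode (into x Γ' Δ' Λₗ Λᵣ π) {z} {Γ} {Δ} {Λ} (x≢ ∷ u) m | _ , u' , disjointₗ | uM , _ , disjointᵣ | inj₂ m'
    with Collect.∈-collect*-mid⁻ (formulaeAt side) Λₗ (π ⟪ node z Γ Δ Λ ⟫) Λᵣ m'
  ... | inj₁ k = ⊥-elim (disjointₗ (formula⇒label* Λₗ k) (∈-++⁺ˡ (Collect.collect-⟪⟫⁺ labelAt π (here refl))))
  ... | inj₂ (inj₁ k) = formulaAtNode π uM k
  ... | inj₂ (inj₂ k) = ⊥-elim (disjointᵣ (Collect.collect-⟪⟫⁺ labelAt π (here refl)) (formula⇒label* Λᵣ k))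

labelInfo : ∀ {z} N → z ∈ labels N →
            z ≡ label N ⊎ (Σ ℕ λ b → (label N , b) ∈ edges N) × (Σ ℕ λ a → (a , z) ∈ edges N)
labelInfo* : ∀ {z} r Λ → z ∈ labels* Λ →
             (Σ ℕ λ b → (r , b) ∈ edges* r Λ) × (Σ ℕ λ a → (a , z) ∈ edges* r Λ)
labelInfo (node x Γ Δ Λ) (here refl) = inj₁ refl
labelInfo (node x Γ Δ Λ) (there m) = inj₂ (labelInfo* x Λ m)
labelInfo* r (c ∷ Λ) m with ∈-++⁻ (labels c) m
... | inj₁ m' with labelInfo c m'
... | inj₁ refl = (label c , here refl) , (r , here refl)
... | inj₂ (_ , (a , k)) = (label c , here refl) , (a , there (∈-++⁺ˡ k))
labelInfo* r (c ∷ Λ) m | inj₂ m' with labelInfo* r Λ m'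
... | (b , k₁) , (a , k₂) = (b , ∈-++⁺ʳ ((r , label c) ∷ edges c) k₁) , (a , ∈-++⁺ʳ ((r , label c) ∷ edges c) k₂)

-- From LbNS to K
--
-- `Represents N ℛ X Y`: the labelled tree N has distinct labels, its edges
-- are exactly the relation terms ℛ, and it contains the labelled formulae
-- X on the left and Y on the right.  Every rule of LbNS preserves this
-- invariant backwards, and acts at the node of its principal label, where
-- it is an admissible rule of K.

record Represents (N : LTree) (ℛ : List Rel) (X Y : List LFm) : Set where
  constructor represents
  field
    distinct : Unique (labels N)
    edges⊇   : ℛ ⊆ edges N
    edges⊆   : edges N ⊆ ℛ
    lefts⊇   : X ⊆ formulae left N
    rights⊇  : Y ⊆ formulae right N
open Represents

keepSide : ∀ z Ψ {Γ : List Fm} {V : List LFm} → (z ∶ Ψ) ++ V ⊆ (z ∶ (Ψ ++ Γ)) ++ V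
keepSide z Ψ {Γ} {V} m = subst (_ ∈_) (sym split) (⊆.++⁺ʳ (z ∶ Ψ) (⊆.xs⊆ys++xs V (z ∶ Γ)) m)
  where split : (z ∶ (Ψ ++ Γ)) ++ V ≡ (z ∶ Ψ) ++ (z ∶ Γ) ++ V
        split = ≡.trans (cong (_++ V) (map-++ (λ A → (z , A)) Ψ Γ)) (++-assoc (z ∶ Ψ) (z ∶ Γ) V)

replaceSide : ∀ z Ψ {Γ : List Fm} {W : LFm} {V : List LFm} → (z ∶ Ψ) ++ V ⊆ (z ∶ (Ψ ++ Γ)) ++ W ∷ V
replaceSide z Ψ {Γ} {W} {V} = ⊆.⊆-trans (keepSide z Ψ {Γ} {V}) (⊆.++⁺ʳ (z ∶ (Ψ ++ Γ)) (⊆.xs⊆x∷xs V W))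

growNode : ∀ π {z Γ Δ Λ Γ' Δ' ℛ X Y X' Y'} → Represents (π ⟪ node z Γ Δ Λ ⟫) ℛ X Y →
           Γ ⊆ Γ' → Δ ⊆ Δ' → X' ⊆ (z ∶ Γ') ++ X → Y' ⊆ (z ∶ Δ') ++ Y →
           Represents (π ⟪ node z Γ' Δ' Λ ⟫) ℛ X' Y'
growNode π {z} {Γ} {Δ} {Λ} {Γ'} {Δ'} rep Γ⊆ Δ⊆ X'⊆ Y'⊆ = represents
  (Unique-↭ (↭-sym (Collect.collect-⟪⟫-↭ labelAt π [] ↭-refl)) (distinct rep))
  (λ m → edges-⟪⟫-⊆ π [] refl ⊆.⊆-refl (edges⊇ rep m))
  (λ m → edges⊆ rep (edges-⟪⟫-⊆ π [] refl ⊆.⊆-refl m))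
  (⊆.⊆-trans X'⊆ (grown left (lefts⊇ rep) (⊆.++⁺ˡ (collect* (formulaeAt left) Λ) (∶-⊆ Γ⊆))))
  (⊆.⊆-trans Y'⊆ (grown right (rights⊇ rep) (⊆.++⁺ˡ (collect* (formulaeAt right) Λ) (∶-⊆ Δ⊆))))
  where
  ∶-⊆ : ∀ {Ψ Ψ'} → Ψ ⊆ Ψ' → (z ∶ Ψ) ⊆ (z ∶ Ψ')
  ∶-⊆ = ⊆.map⁺ (λ A → (z , A))
  grown : ∀ side {V} → V ⊆ formulae side (π ⟪ node z Γ Δ Λ ⟫) →
          formulae side (node z Γ Δ Λ) ⊆ formulae side (node z Γ' Δ' Λ) →
          (z ∶ side Γ' Δ') ++ V ⊆ formulae side (π ⟪ node z Γ' Δ' Λ ⟫)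
  grown side V⊆ M⊆ m with ∈-++⁻ (z ∶ side Γ' Δ') m
  ... | inj₁ k = Collect.collect-⟪⟫⁺ (formulaeAt side) π (∈-++⁺ˡ k)
  ... | inj₂ k = Collect.collect-⟪⟫-⊆ (formulaeAt side) π [] M⊆ (V⊆ k)

fresh∉labels : ∀ {N ℛ X Y x y} → Represents N ℛ X Y → x ∈ labels N → y ≢ x →
               All (λ r → (proj₁ r ≢ y) × (proj₂ r ≢ y)) ℛ → y ∉ labels N
fresh∉labels {N} rep x∈ y≢x freshℛ y∈ with labelInfo N y∈
... | inj₂ (_ , (_ , into-y)) = proj₂ (All.lookup freshℛ (edges⊆ rep into-y)) refl
... | inj₁ y≡root with labelInfo N x∈
...   | inj₁ x≡root = y≢x (≡.trans y≡root (sym x≡root))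
...   | inj₂ ((_ , from-root) , _) = proj₁ (All.lookup freshℛ (edges⊆ rep from-root)) (sym y≡root)

addLeaf : ∀ π {x Γ Δ Λ y A B ℛ X Y} → y ∉ labels (π ⟪ node x Γ Δ Λ ⟫) →
          Represents (π ⟪ node x Γ Δ Λ ⟫) ℛ X Y →
          Represents (π ⟪ node x Γ Δ (Λ ∷ʳ node y [ A ] [ B ] []) ⟫) ((x , y) ∷ ℛ) ((y , A) ∷ X) ((y , B) ∷ Y)
addLeaf π {x} {Γ} {Δ} {Λ} {y} {A} {B} {ℛ} y∉ rep = represents
  (Unique-↭ (↭-sym (Collect.collect-⟪⟫-↭ labelAt π [ y ] labels-grow)) (AllP.¬Any⇒All¬ _ y∉ ∷ distinct rep))
  (λ { (here refl) → edges-⟪⟫⁺ π (∈-edges*-mid⁺ x Λ leaf [] (inj₂ (inj₁ (here refl))))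
     ; (there m) → edges-⟪⟫-⊆ π [] refl (λ k → ∈-edges*-mid⁺ x Λ leaf [] (inj₁ k)) (edges⊇ rep m) })
  (λ m → edges-shrink (edges-⟪⟫-⊆ π [ (x , y) ] refl edges-grow m))
  (λ { (here refl) → Collect.collect-⟪⟫⁺ (formulaeAt left) π (new-formula left (here refl))
     ; (there m) → old-formulae left (lefts⊇ rep m) })
  (λ { (here refl) → Collect.collect-⟪⟫⁺ (formulaeAt right) π (new-formula right (here refl))
     ; (there m) → old-formulae right (rights⊇ rep m) })
  where
  leaf = node y [ A ] [ B ] []
  labels-grow : labels (node x Γ Δ (Λ ∷ʳ leaf)) ↭ y ∷ labels (node x Γ Δ Λ)
  labels-grow = ↭-trans (prep x (↭-trans (↭-reflexive (Collect.collect*-mid labelAt Λ leaf []))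
                                          (↭-sym (∷↭∷ʳ y (labels* Λ)))))
                        (swap₂ x y)
  edges-grow : edges (node x Γ Δ (Λ ∷ʳ leaf)) ⊆ [ (x , y) ] ++ edges (node x Γ Δ Λ)
  edges-grow m with ∈-edges*-mid⁻ x Λ leaf [] m
  ... | inj₁ k = there k
  ... | inj₂ (inj₁ (here refl)) = here refl
  edges-shrink : ∀ {r} → r ∈ (x , y) ∷ edges (π ⟪ node x Γ Δ Λ ⟫) → r ∈ (x , y) ∷ ℛ
  edges-shrink (here e) = here e
  edges-shrink (there m) = there (edges⊆ rep m)
  new-formula : ∀ side {φ} → φ ∈ side [ A ] [ B ] → (y , φ) ∈ formulae side (node x Γ Δ (Λ ∷ʳ leaf))
  new-formula side φ∈ = ∈-++⁺ʳ (x ∶ side Γ Δ)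
    (Collect.∈-collect*-mid⁺ (formulaeAt side) Λ leaf [] (inj₂ (inj₁ (∈-++⁺ˡ (∈-map⁺ (λ C → (y , C)) φ∈)))))
  old-formulae : ∀ side → formulae side (π ⟪ node x Γ Δ Λ ⟫) ⊆ formulae side (π ⟪ node x Γ Δ (Λ ∷ʳ leaf) ⟫)
  old-formulae side = Collect.collect-⟪⟫-⊆ (formulaeAt side) π []
    (⊆.++⁺ʳ (x ∶ side Γ Δ) (λ k → Collect.∈-collect*-mid⁺ (formulaeAt side) Λ leaf [] (inj₁ k)))

growChild : ∀ π {x Γ Δ Λₗ Λᵣ y Γc Δc Λc A ℛ X Y} →
            Represents (π ⟪ node x Γ Δ (Λₗ ++ node y Γc Δc Λc ∷ Λᵣ) ⟫) ℛ ((x , A) ∷ X) Y →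
            Represents (π ⟪ node x Γ Δ (Λₗ ++ node y (A ∷ Γc) Δc Λc ∷ Λᵣ) ⟫) ℛ ((x , A) ∷ (y , A) ∷ X) Y
growChild π {x} {Γ} {Δ} {Λₗ} {Λᵣ} {y} {Γc} {Δc} {Λc} {A} rep =
  subst (λ M → Represents M _ _ _) (⊙-⟪⟫ π toChild (node y (A ∷ Γc) Δc Λc))
    (growNode (π ⊙ toChild) (subst (λ M → Represents M _ _ _) (sym (⊙-⟪⟫ π toChild (node y Γc Δc Λc))) rep)
       (⊆.xs⊆x∷xs Γc A) ⊆.⊆-refl (⊆.⊆-trans (⊆.⊆-reflexive-↭ (swap₂ _ _)) (keepSide y [ A ])) (⊆.xs⊆ys++xs _ _))
  where toChild = into x Γ Δ Λₗ Λᵣ top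

data Carrier (side : Side) (z : ℕ) (φ : Fm) (N : LTree) : Set where
  carrier : ∀ π Γ Δ Λ → N ≡ π ⟪ node z Γ Δ Λ ⟫ → φ ∈ side Γ Δ → Carrier side z φ N

carrierOf : ∀ side N {z φ} → Unique (labels N) → (z , φ) ∈ formulae side N → Carrier side z φ N
carrierOf side N u m with findNode N (formula⇒label side N m)
... | nodeAt π Γ Δ Λ refl = carrier π Γ Δ Λ refl (formulaAtNode side π u m)

leftCarrier : ∀ {N ℛ X Y z φ} → Represents N ℛ X Y → (z , φ) ∈ X → Carrier left z φ N
leftCarrier {N} rep m = carrierOf left N (distinct rep) (lefts⊇ rep m)

rightCarrier : ∀ {N ℛ X Y z φ} → Represents N ℛ X Y → (z , φ) ∈ Y → Carrier right z φ N
rightCarrier {N} rep m = carrierOf right N (distinct rep) (rights⊇ rep m)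

absorbᴷL : ∀ {Q Γ Δ Λ} → Q ∈ Γ → Rule₁ (nest (Q ∷ Γ) Δ Λ) (nest Γ Δ Λ)
absorbᴷL {Λ = Λ} Q∈Γ Σ' d = kmono d (absorbAt Σ' (∈-++⁺ʳ Σ' Q∈Γ)) ⊆.⊆-refl (≼*-refl Λ)

absorbᴷR : ∀ {Q Γ Δ Λ} → Q ∈ Δ → Rule₁ (nest Γ (Q ∷ Δ) Λ) (nest Γ Δ Λ)
absorbᴷR {Λ = Λ} Q∈Δ Σ' d = kmono d ⊆.⊆-refl (⊆.∈-∷⁺ʳ Q∈Δ ⊆.⊆-refl) (≼*-refl Λ)

⊃Rᴸᵇ : ∀ {x Γ Δ Λ y A B} → A ⊃ B ∈ Δ →
       Rule₁ (erase (node x Γ Δ (Λ ∷ʳ node y [ A ] [ B ] []))) (erase (node x Γ Δ Λ))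
⊃Rᴸᵇ {Λ = Λ} {y} {A} {B} A⊃B∈Δ Σ' d rewrite erase*-∷ʳ Λ (node y [ A ] [ B ] []) =
  absorbᴷR A⊃B∈Δ Σ' (⊃Rᴷ Σ' d)

liftIntoChild : ∀ {x Γ Δ y Γc Δc Λc A} Λₗ Λᵣ → A ∈ Γ →
                Rule₁ (erase (node x Γ Δ (Λₗ ++ node y (A ∷ Γc) Δc Λc ∷ Λᵣ)))
                      (erase (node x Γ Δ (Λₗ ++ node y Γc Δc Λc ∷ Λᵣ)))
liftIntoChild {y = y} {Γc} {Δc} {Λc} {A} Λₗ Λᵣ A∈Γ Σ' d
  rewrite erase*-mid Λₗ (node y (A ∷ Γc) Δc Λc) Λᵣ | erase*-mid Λₗ (node y Γc Δc Λc) Λᵣ =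
  liftChild (erase* Λₗ) (erase* Λᵣ) (∈-++⁺ʳ Σ' A∈Γ) d

ruleAt₀ : ∀ π {M} → Rule₀ (erase M) → K₀ (erase (π ⟪ M ⟫))
ruleAt₀ π {M} r rewrite erase-⟪⟫ π M = deep₀ r (erasePath π) []

ruleAt₁ : ∀ π {M₁ M} → Rule₁ (erase M₁) (erase M) → K₀ (erase (π ⟪ M₁ ⟫)) → K₀ (erase (π ⟪ M ⟫))
ruleAt₁ π {M₁} {M} r rewrite erase-⟪⟫ π M₁ | erase-⟪⟫ π M = deep₁ r (erasePath π) []

ruleAt₂ : ∀ π {M₁ M₂ M} → Rule₂ (erase M₁) (erase M₂) (erase M) →
          K₀ (erase (π ⟪ M₁ ⟫)) → K₀ (erase (π ⟪ M₂ ⟫)) → K₀ (erase (π ⟪ M ⟫))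
ruleAt₂ π {M₁} {M₂} {M} r rewrite erase-⟪⟫ π M₁ | erase-⟪⟫ π M₂ | erase-⟪⟫ π M = deep₂ r (erasePath π) []

LbNS⇒K : ∀ {ℛ X Y} → LbNS⊢ ℛ ∣ X ⇒ Y → ∀ N → Represents N ℛ X Y → K₀ (erase N)
LbNS⇒K (perm r px py d) N rep = LbNS⇒K d N (represents (distinct rep)
  (λ m → edges⊇ rep (∈-resp-↭ r m)) (λ m → ∈-resp-↭ (↭-sym r) (edges⊆ rep m))
  (λ m → lefts⊇ rep (∈-resp-↭ px m)) (λ m → rights⊇ rep (∈-resp-↭ py m)))
LbNS⇒K ax⊥ N rep with leftCarrier rep (here refl)
... | carrier π Γ Δ Λ refl ⊥∈Γ = ruleAt₀ π (λ Σ' → absorbᴷL ⊥∈Γ Σ' (⊥ᴷ Σ'))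
LbNS⇒K (init p) N rep with leftCarrier rep (here refl)
... | carrier π Γ Δ Λ refl P∈Γ =
  ruleAt₀ π (λ Σ' → absorbᴷL P∈Γ Σ' (absorbᴷR P∈Δ Σ' (idᴷ (atom p) Σ')))
  where P∈Δ : atom p ∈ Δ
        P∈Δ = formulaAtNode right π (distinct rep) (rights⊇ rep (here refl))
LbNS⇒K (∧L {x = z} {A} {B} d) N rep with leftCarrier rep (here refl)
... | carrier π Γ Δ Λ refl A∧B∈Γ =
  ruleAt₁ π (λ Σ' e → absorbᴷL A∧B∈Γ Σ' (∧Lᴷ Σ' e))
    (LbNS⇒K d _ (growNode π rep (⊆.xs⊆ys++xs Γ (A ∷ B ∷ [])) ⊆.⊆-refl
                   (replaceSide z (A ∷ B ∷ [])) (⊆.xs⊆ys++xs _ _)))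
LbNS⇒K (∧R {x = z} {A} {B} d₁ d₂) N rep with rightCarrier rep (here refl)
... | carrier π Γ Δ Λ refl A∧B∈Δ =
  ruleAt₂ π (λ Σ' e₁ e₂ → absorbᴷR A∧B∈Δ Σ' (∧Rᴷ Σ' e₁ e₂))
    (LbNS⇒K d₁ _ (growNode π rep ⊆.⊆-refl (⊆.xs⊆ys++xs Δ [ A ]) (⊆.xs⊆ys++xs _ _) (replaceSide z [ A ])))
    (LbNS⇒K d₂ _ (growNode π rep ⊆.⊆-refl (⊆.xs⊆ys++xs Δ [ B ]) (⊆.xs⊆ys++xs _ _) (replaceSide z [ B ])))
LbNS⇒K (∨L {x = z} {A} {B} d₁ d₂) N rep with leftCarrier rep (here refl)
... | carrier π Γ Δ Λ refl A∨B∈Γ =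
  ruleAt₂ π (λ Σ' e₁ e₂ → absorbᴷL A∨B∈Γ Σ' (∨Lᴷ Σ' e₁ e₂))
    (LbNS⇒K d₁ _ (growNode π rep (⊆.xs⊆ys++xs Γ [ A ]) ⊆.⊆-refl (replaceSide z [ A ]) (⊆.xs⊆ys++xs _ _)))
    (LbNS⇒K d₂ _ (growNode π rep (⊆.xs⊆ys++xs Γ [ B ]) ⊆.⊆-refl (replaceSide z [ B ]) (⊆.xs⊆ys++xs _ _)))
LbNS⇒K (∨R {x = z} {A} {B} d) N rep with rightCarrier rep (here refl)
... | carrier π Γ Δ Λ refl A∨B∈Δ =
  ruleAt₁ π (λ Σ' e → absorbᴷR A∨B∈Δ Σ' (∨Rᴷ Σ' e))
    (LbNS⇒K d _ (growNode π rep ⊆.⊆-refl (⊆.xs⊆ys++xs Δ (A ∷ B ∷ [])) (⊆.xs⊆ys++xs _ _)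
                   (replaceSide z (A ∷ B ∷ []))))
LbNS⇒K (⊃L {x = z} {A} {B} d₁ d₂) N rep with leftCarrier rep (here refl)
... | carrier π Γ Δ Λ refl A⊃B∈Γ =
  ruleAt₂ π (λ Σ' e₁ e₂ → absorbᴷL A⊃B∈Γ Σ' (⊃Lᴷ Σ' e₁ e₂))
    (LbNS⇒K d₁ _ (growNode π rep (⊆.xs⊆ys++xs Γ [ A ⊃ B ]) (⊆.xs⊆ys++xs Δ [ A ])
                    (⊆.xs⊆ys++xs _ (z ∶ (A ⊃ B ∷ Γ))) (keepSide z [ A ])))
    (LbNS⇒K d₂ _ (growNode π rep (⊆.xs⊆ys++xs Γ [ B ]) ⊆.⊆-refl (replaceSide z [ B ]) (⊆.xs⊆ys++xs _ _)))
LbNS⇒K (⊃R {ℛ} {X} {Y} {x} {y} {A} {B} (y≢x , freshℛ , _) d) N rep with rightCarrier rep (here refl)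
... | carrier π Γ Δ Λ refl A⊃B∈Δ =
  ruleAt₁ π (⊃Rᴸᵇ {x = x} {y = y} A⊃B∈Δ) (LbNS⇒K d _ (addLeaf π (fresh∉labels rep x∈ y≢x freshℛ) rep-rest))
  where
  x∈ : x ∈ labels (π ⟪ node x Γ Δ Λ ⟫)
  x∈ = formula⇒label right (π ⟪ node x Γ Δ Λ ⟫) (rights⊇ rep (here refl))
  rep-rest : Represents (π ⟪ node x Γ Δ Λ ⟫) ℛ X Y
  rep-rest = represents (distinct rep) (edges⊇ rep) (edges⊆ rep) (lefts⊇ rep) (λ m → rights⊇ rep (there m))
LbNS⇒K (lift {x = x} {y} {A} d) N rep with findEdge N (edges⊇ rep (here refl))
... | edgeAt π Γ Δ Λₗ (node _ Γc Δc Λc) Λᵣ refl refl =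
  ruleAt₁ π (liftIntoChild {x = x} {y = y} Λₗ Λᵣ A∈Γ) (LbNS⇒K d _ (growChild π rep))
  where A∈Γ : A ∈ Γ
        A∈Γ = formulaAtNode left π (distinct rep) (lefts⊇ rep (here refl))

-- x:Γ ⊢ x:Δ is represented by the one-node tree
LbNS⇒mLJ : ∀ {Γ Δ x} → LbNS⊢ [] ∣ x ∶ Γ ⇒ x ∶ Δ → mLJ⊢ Γ ⇒ Δ
LbNS⇒mLJ {Γ} {Δ} {x} d =
  K⇒mLJ₀ (LbNS⇒K d (node x Γ Δ []) (represents ([] ∷ []) (λ ()) (λ ()) ∈-++⁺ˡ ∈-++⁺ˡ))

mLJ⇒LbNS₀ : ∀ {Γ Δ} x → mLJ⊢ Γ ⇒ Δ → LbNS⊢ [] ∣ x ∶ Γ ⇒ x ∶ Δ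
mLJ⇒LbNS₀ {Γ} {Δ} x d =
  perm ↭-refl (↭-reflexive (++-identityʳ (x ∶ Γ))) (↭-reflexive (++-identityʳ (x ∶ Δ))) (mLJ⇒LbNS d [] [] [] x)

theorem4 : (Γ Δ : List Fm) →
    ((mLJ⊢ Γ ⇒ Δ) ⇔ (NS⊢ nest Γ Δ []))
    × ((mLJ⊢ Γ ⇒ Δ) ⇔ (LNS⊢ [ (Γ , Δ) ]))
    × ((x : ℕ) → (mLJ⊢ Γ ⇒ Δ) ⇔ (LbNS⊢ [] ∣ x ∶ Γ ⇒ x ∶ Δ))
theorem4 Γ Δ =
  mk⇔ (λ d → mLJ⇒NS d hole []) (λ d → K⇒mLJ₀ (NS⇒K d)) ,
  mk⇔ (λ d → mLJ⇒LNS d []) (λ d → K⇒mLJ₀ (LNS⇒K d)) ,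
  λ x → mk⇔ (mLJ⇒LbNS₀ x) LbNS⇒mLJ
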